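{- Let $j$ be a positive integer. For every positive integer $n$, $\overline{p}_{1,j}(n)=\sum_{m\geq j}M(m,n)$, i.e. $\overline{p}_{1,j}(n)$ equals the number of partitions of $n$ with crank $\geq j$.
   Context: A partition of $n$ is a finite multiset of positive integers summing to $n$. The crank of a partition is its largest part if $1$ is not a part, and otherwise it is (the number of parts larger than the number of ones) minus (the number of ones). $M(m,n)$ denotes the number of partitions of $n$ with crank $m$, except that for $n=1$ one uses the standard convention $M(-1,1)=M(1,1)=1$, $M(0,1)=-1$ and $M(m,1)=0$ otherwise (so that $\sum_{n\ge0}M(m,n)q^n=\frac{1}{(q;q)_\infty}\sum_{k\geq1}(-1)^{k-1}q^{k(k-1)/2+k|m|}(1-q^k)$); "number of partitions of $n$ with crank $\geq j$" means $\sum_{m\ge j}M(m,n)$. For positive integers $A,a$ and a partition $\pi$, $\mathrm{mex}_{A,a}(\pi)$ is the smallest element of $\{a,a+A,a+2A,\dots\}$ that is not a part of $\pi$. $\overline{p}_{A,a}(n)$ is the number of partitions $\pi$ of $n$ with $\mathrm{mex}_{A,a}(\pi)\equiv A+a \pmod{2A}$. -}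

module Defs where

open import Data.Nat using (ℕ; zero; suc; _+_; _*_; _∸_; _≤_; _<_; _≤ᵇ_; _≡ᵇ_; _⊔_; NonZero)
open import Data.Nat.DivMod using (_%_)
open import Data.Bool using (Bool; true; false; if_then_else_; not; T)
open import Data.Bool.Properties using (T?)
open import Data.Bool.ListAction using (any)
open import Data.List using (List; []; _∷_; concatMap; map; filter; length; sum; upTo; foldr)
open import Data.Integer using (ℤ; +_; -_; _-_) renaming (_+_ to _+ℤ_; _≤_ to _≤ℤ_)
import Data.Integer as ℤ
open import Relation.Nullary using (Dec; yes; no)
open import Relation.Nullary.Decidable using (⌊_⌋)
open import Relation.Unary using (Decidable)

-- partitions of n (using fuel ≥ n) whose parts are all ≤ k, each
-- listed once as a weakly decreasing list of positive integers.
partsBounded : (fuel n k : ℕ) → List (List ℕ)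
partsBounded fuel zero k = [] ∷ []
partsBounded zero (suc n) k = []
partsBounded (suc fuel) (suc n) k =
  concatMap (λ i → let p = suc i in
                   if p ≤ᵇ k
                   then map (p ∷_) (partsBounded fuel (suc n ∸ p) p)
                   else [])
            (upTo (suc n))

partitions : ℕ → List (List ℕ)
partitions n = partsBounded n n n

countPartitions : (List ℕ → Bool) → ℕ → ℕ
countPartitions P n = length (filter (λ π → T? (P π)) (partitions n))

countB : (ℕ → Bool) → List ℕ → ℕ
countB P [] = 0
countB P (x ∷ xs) = if P x then suc (countB P xs) else countB P xs

largestPart : List ℕ → ℕ
largestPart = foldr _⊔_ 0

ω : List ℕ → ℕ
ω = countB (λ x → x ≡ᵇ 1)

μ : List ℕ → ℕ
μ π = countB (λ x → not (x ≤ᵇ ω π)) π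

crank : List ℕ → ℤ
crank π with ω π
... | zero  = + largestPart π
... | suc k = (+ μ π) - (+ suc k)

-- M(m,n), with the standard convention for n = 1
M : ℤ → ℕ → ℤ
M m 1 with m ℤ.≟ + 1 | m ℤ.≟ - (+ 1) | m ℤ.≟ + 0
... | yes _ | _ | _ = + 1
... | no _ | yes _ | _ = + 1
... | no _ | no _ | yes _ = - (+ 1)
... | no _ | no _ | no _ = + 0
M m n = + countPartitions (λ π → ⌊ crank π ℤ.≟ m ⌋) n

-- Σ_{m ≥ j} M(m,n) for j a natural number.  Since every partition of n
-- has crank ≤ n (and M(m,1) = 0 for m ≥ 2), M(m,n) = 0 for m > n ⊔ 1,
-- so the infinite sum equals the finite sum over j ≤ m ≤ n ⊔ 1.
sumRange : (ℕ → ℤ) → (start len : ℕ) → ℤ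
sumRange f start zero = + 0
sumRange f start (suc len) = f start +ℤ sumRange f (suc start) len

crankGeqCount : (j n : ℕ) → ℤ
crankGeqCount j n = sumRange (λ m → M (+ m) n) j (suc (n ⊔ 1) ∸ j)

memB : ℕ → List ℕ → Bool
memB x = any (λ y → x ≡ᵇ y)

-- smallest element of {a + k A | k ≥ start} not in π, searching with fuel;
-- fuel = length π + 1 suffices since π has at most length π distinct parts.
mexFrom : (fuel A a k : ℕ) → List ℕ → ℕ
mexFrom zero A a k π = a + k * A
mexFrom (suc fuel) A a k π =
  if memB (a + k * A) π then mexFrom fuel A a (suc k) π else a + k * A

mex : (A a : ℕ) → List ℕ → ℕ
mex A a π = mexFrom (suc (length π)) A a 0 π

pbar : (A a : ℕ) → {{NonZero A}} → ℕ → ℕ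
pbar (suc A′) a n = countPartitions
  (λ π → (mex A a π % (2 * A)) ≡ᵇ ((A + a) % (2 * A))) n
  where A = suc A′

open import Relation.Binary.PropositionalEquality using (_≡_; refl)
private
  t1 : length (partitions 6) ≡ 11
  t1 = refl
  t2 : crank (3 ∷ 1 ∷ 1 ∷ []) ≡ - (+ 1)
  t2 = refl
  t3 : (+ pbar 1 1 5) ≡ crankGeqCount 1 5
  t3 = refl
  t4 : (+ pbar 1 2 7) ≡ crankGeqCount 2 7
  t4 = refl
  t5 : (+ pbar 1 1 1) ≡ crankGeqCount 1 1
  t5 = refl
  t6 : (+ pbar 1 3 8) ≡ crankGeqCount 3 8
  t6 = refl

{-# OPTIONS --safe #-}
-- Both E_j(n) = p̄_{1,j}(n) and C_j(n) = Σ_{m≥j} M(m,n) satisfy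
--   X_j(j + M) + X_{j+1}(M) = p(M)   and   X_j(n) = 0 for n < j,
-- and these relations determine X_j(n) by induction on n.
-- For E: a partition of j + M whose mex_{1,j} has the parity of j + 1 must contain j,
-- and removing one part j turns mex_{1,j} into mex_{1,j+1}, negating the parity condition.
-- For C: as crank ≤ j and crank ≥ j + 1 are complementary, the recurrence says that the
-- partitions of M + j with crank ≥ j are as many as the partitions of M with crank ≤ j.
-- Writing the crank as (largest part or μ) − ω and sorting both sides by the size of that
-- minuend, resp. by the number of ones, the two sides match slice by slice; each slice is
-- handled by explicit bijections (remove the largest part, the ones, one part 1, or the
-- first column; raise the first K parts) and by the conjugation identity
-- #{π ⊢ N : ℓ(π) ≤ K} = #{π ⊢ N : π₁ ≤ K}.

module Submission where

open import Defs
open import Data.Bool using (Bool; true; false; if_then_else_; not; T; _∧_; _∨_)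
open import Data.Bool.Properties using (T?; T-∧; ∧-identityʳ; ∧-zeroʳ; ∧-comm; ∨-assoc; ∨-comm; not-involutive)
open import Data.Empty using (⊥-elim)
import Data.Integer as ℤ
import Data.Integer.Properties as ℤ
open import Data.List using (List; []; _∷_; _++_; map; filter; length; upTo; replicate; drop)
open import Data.List.Membership.Propositional using (_∈_; find)
open import Data.List.Membership.Propositional.Properties
  using (∈-concatMap⁻; ∈-concatMap⁺; ∈-upTo⁻; ∈-upTo⁺; ∈-map⁻; ∈-map⁺; ∈-filter⁻; ∈-filter⁺)
open import Data.List.Membership.Propositional.Properties.WithK using (unique∧set⇒bag)
open import Data.List.Properties using (length-map; length-++; length-replicate; map-∘; map-id; map-id-local; filter-none)
open import Data.List.Relation.Binary.BagAndSetEquality using (∼bag⇒↭)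
open import Data.List.Relation.Binary.Disjoint.Propositional using (Disjoint)
open import Data.List.Relation.Binary.Permutation.Propositional.Properties using (↭-length)
open import Data.List.Relation.Unary.All as All using (All; []; _∷_)
import Data.List.Relation.Unary.All.Properties as All
open import Data.List.Relation.Unary.AllPairs as AllPairs using (AllPairs; []; _∷_)
import Data.List.Relation.Unary.AllPairs.Properties as AllPairs
open import Data.List.Relation.Unary.Any as Any using (Any; here; there)
open import Data.List.Relation.Unary.Unique.Propositional using (Unique)
import Data.List.Relation.Unary.Unique.Propositional.Properties as Unique
open import Data.Nat using (ℕ; zero; suc; pred; _+_; _*_; _∸_; _⊔_; _≤_; _<_; _≤ᵇ_; _≡ᵇ_; _≤?_; z≤n; s≤s; s≤s⁻¹)
open import Data.Nat.DivMod using (_%_)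
open import Data.Nat.Induction using (<-rec)
open import Data.Nat.ListAction using (sum)
open import Data.Nat.ListAction.Properties using (sum-++)
open import Data.Nat.Properties
open import Algebra.Properties.CommutativeSemigroup +-commutativeSemigroup using (x∙yz≈y∙xz; xy∙z≈xz∙y)
open import Data.Product using (_×_; _,_; proj₁; proj₂)
open import Data.Sum using (_⊎_; inj₁; inj₂)
open import Function using (id; _∘_)
open import Function.Bundles using (_⇔_; mk⇔; Equivalence)
open import Relation.Nullary using (¬_; yes; no)
open import Relation.Nullary.Decidable using (⌊_⌋; toWitness; fromWitness)
open import Relation.Binary.PropositionalEquality

∧-intro : ∀ {a b} → T a → T b → T (a ∧ b)
∧-intro ta tb = Equivalence.from T-∧ (ta , tb)

∧-elim : ∀ {a b} → T (a ∧ b) → T a × T b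
∧-elim = Equivalence.to T-∧

true⇒T : ∀ {b} → b ≡ true → T b
true⇒T refl = _

false⇒¬T : ∀ {b} → b ≡ false → ¬ T b
false⇒¬T refl ()

T⇒true : ∀ {b} → T b → b ≡ true
T⇒true {true} _ = refl

T-not⁻ : ∀ {b} → T (not b) → ¬ T b
T-not⁻ {true} ()

T-not⁺ : ∀ {b} → ¬ T b → T (not b)
T-not⁺ {true}  ¬t = ¬t _
T-not⁺ {false} _  = _

≡ᵇ-∧-subst : ∀ m n (X : ℕ → Bool) → (m ≡ᵇ n) ∧ X m ≡ (m ≡ᵇ n) ∧ X n
≡ᵇ-∧-subst m n X with m ≡ᵇ n in m≡ᵇn
... | false = refl
... | true with refl ← ≡ᵇ⇒≡ m n (true⇒T m≡ᵇn) = refl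

≢⇒≡ᵇ≡false : ∀ {m n} → m ≢ n → (m ≡ᵇ n) ≡ false
≢⇒≡ᵇ≡false {m} {n} m≢n with m ≡ᵇ n in m≡ᵇn
... | true  = ⊥-elim (m≢n (≡ᵇ⇒≡ m n (true⇒T m≡ᵇn)))
... | false = refl

suc≤ᵇsuc : ∀ m n → (suc m ≤ᵇ suc n) ≡ (m ≤ᵇ n)
suc≤ᵇsuc zero    n = refl
suc≤ᵇsuc (suc m) n = refl

data Parts≤ (k : ℕ) : List ℕ → Set where
  []   : Parts≤ k []
  cons : ∀ {x xs} → 1 ≤ x → x ≤ k → Parts≤ x xs → Parts≤ k (x ∷ xs)

infix 4 _⊢_

_⊢_ : List ℕ → ℕ → Set
π ⊢ n = Parts≤ n π × sum π ≡ n

firstPart : List ℕ → ℕ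
firstPart []      = 0
firstPart (x ∷ _) = x

Parts≤-weaken : ∀ {k k′ π} → k ≤ k′ → Parts≤ k π → Parts≤ k′ π
Parts≤-weaken k≤k′ []               = []
Parts≤-weaken k≤k′ (cons 1≤x x≤k p) = cons 1≤x (≤-trans x≤k k≤k′) p

Parts≤-firstPart : ∀ {k π} → Parts≤ k π → Parts≤ (firstPart π) π
Parts≤-firstPart []             = []
Parts≤-firstPart (cons 1≤x _ p) = cons 1≤x ≤-refl p

firstPart≤ : ∀ {k π} → Parts≤ k π → firstPart π ≤ k
firstPart≤ []             = z≤n
firstPart≤ (cons _ x≤k _) = x≤k

firstPart≤sum : ∀ π → firstPart π ≤ sum π
firstPart≤sum []       = z≤n
firstPart≤sum (x ∷ xs) = m≤m+n x (sum xs)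

length≤sum : ∀ {k π} → Parts≤ k π → length π ≤ sum π
length≤sum []             = z≤n
length≤sum (cons 1≤x _ p) = +-mono-≤ 1≤x (length≤sum p)

⊢-intro : ∀ {k π n} → Parts≤ k π → sum π ≡ n → π ⊢ n
⊢-intro {π = π} p refl = Parts≤-weaken (≤-trans (firstPart≤ p′) (firstPart≤sum π)) p′ , refl
  where p′ = Parts≤-firstPart p

private
  branch : (fuel n k i : ℕ) → List (List ℕ)
  branch fuel n k i =
    if suc i ≤ᵇ k then map (suc i ∷_) (partsBounded fuel (n ∸ i) (suc i)) else []

partsBounded-sound : ∀ fuel n k {π} → π ∈ partsBounded fuel n k → Parts≤ k π × sum π ≡ n
partsBounded-sound fuel       zero    k (here refl) = [] , refl
partsBounded-sound (suc fuel) (suc n) k π∈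
  with i , i∈ , π∈branch ← find (∈-concatMap⁻ (branch fuel n k) {xs = upTo (suc n)} π∈)
  with suc i ≤ᵇ k in i<k
... | true with ρ , ρ∈ , refl ← ∈-map⁻ (suc i ∷_) π∈branch
  with p , sumρ ← partsBounded-sound fuel (n ∸ i) (suc i) ρ∈ =
  cons (s≤s z≤n) (≤ᵇ⇒≤ (suc i) k (true⇒T i<k)) p ,
  cong suc (trans (cong (i +_) sumρ) (m+[n∸m]≡n (s≤s⁻¹ (∈-upTo⁻ i∈))))

partsBounded-complete : ∀ fuel n k {π} → Parts≤ k π → sum π ≡ n → n ≤ fuel → π ∈ partsBounded fuel n k
partsBounded-complete fuel       zero    k []  _  _ = here refl
partsBounded-complete fuel       zero    k (cons (s≤s _) _ _) () _
partsBounded-complete fuel       (suc n) k [] () _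
partsBounded-complete (suc fuel) (suc n) k {suc i ∷ ρ} (cons _ i<k p) sum≡ n<fuel =
  ∈-concatMap⁺ (branch fuel n k) {xs = upTo (suc n)} (Any.map (λ { refl → π∈branch }) (∈-upTo⁺ i<n))
  where
  sumρ : i + sum ρ ≡ n
  sumρ = suc-injective sum≡
  i<n : i < suc n
  i<n = s≤s (subst (i ≤_) sumρ (m≤m+n i (sum ρ)))
  π∈branch : suc i ∷ ρ ∈ branch fuel n k i
  π∈branch with suc i ≤ᵇ k | ≤⇒≤ᵇ i<k
  ... | true | _ = ∈-map⁺ (suc i ∷_)
    (partsBounded-complete fuel (n ∸ i) (suc i) p
      (trans (sym (m+n∸m≡n i (sum ρ))) (cong (_∸ i) sumρ))
      (≤-trans (m∸n≤m n i) (s≤s⁻¹ n<fuel)))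

partsBounded-unique : ∀ fuel n k → Unique (partsBounded fuel n k)
partsBounded-unique fuel       zero    k = [] ∷ []
partsBounded-unique zero       (suc n) k = []
partsBounded-unique (suc fuel) (suc n) k =
  Unique.concat⁺ (All.map⁺ (All.universal branch-unique (upTo (suc n))))
                 (AllPairs.map⁺ (AllPairs.map branch-disjoint (Unique.upTo⁺ (suc n))))
  where
  branch-unique : ∀ i → Unique (branch fuel n k i)
  branch-unique i with suc i ≤ᵇ k
  ... | true  = Unique.map⁺ (λ { refl → refl }) (partsBounded-unique fuel (n ∸ i) (suc i))
  ... | false = []
  head∈branch : ∀ {i π} → π ∈ branch fuel n k i → firstPart π ≡ suc i
  head∈branch {i} π∈ with suc i ≤ᵇ k
  ... | true with _ , _ , refl ← ∈-map⁻ (suc i ∷_) π∈ = refl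
  branch-disjoint : ∀ {i i′} → i ≢ i′ → Disjoint (branch fuel n k i) (branch fuel n k i′)
  branch-disjoint i≢i′ (π∈ , π∈′) = i≢i′ (suc-injective (trans (sym (head∈branch π∈)) (head∈branch π∈′)))

∈-partitions⁻ : ∀ {n π} → π ∈ partitions n → π ⊢ n
∈-partitions⁻ {n} = partsBounded-sound n n n

∈-partitions⁺ : ∀ {n π} → π ⊢ n → π ∈ partitions n
∈-partitions⁺ {n} (p , sum≡) = partsBounded-complete n n n p sum≡ ≤-refl

partitions-unique : ∀ n → Unique (partitions n)
partitions-unique n = partsBounded-unique n n n

private
  selected : (List ℕ → Bool) → ℕ → List (List ℕ)
  selected P n = filter (λ π → T? (P π)) (partitions n)

  ∈-selected⁻ : ∀ {P n π} → π ∈ selected P n → π ⊢ n × T (P π)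
  ∈-selected⁻ {P} π∈ with π∈ₙ , Pπ ← ∈-filter⁻ (λ π → T? (P π)) π∈ = ∈-partitions⁻ π∈ₙ , Pπ

  ∈-selected⁺ : ∀ {P n π} → π ⊢ n → T (P π) → π ∈ selected P n
  ∈-selected⁺ {P} π⊢ Pπ = ∈-filter⁺ (λ π → T? (P π)) (∈-partitions⁺ π⊢) Pπ

-- count is opaque so that the predicate P of count P n is found by unification instead of
-- disappearing into the unfolding of countPartitions.
opaque
  count : (List ℕ → Bool) → ℕ → ℕ
  count = countPartitions

  count≡countPartitions : ∀ P n → count P n ≡ countPartitions P n
  count≡countPartitions P n = refl

  count-bij : ∀ {P Q : List ℕ → Bool} {m n} (f g : List ℕ → List ℕ) →
    (∀ {π} → π ⊢ m → T (P π) → f π ⊢ n × T (Q (f π)) × g (f π) ≡ π) →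
    (∀ {σ} → σ ⊢ n → T (Q σ) → g σ ⊢ m × T (P (g σ)) × f (g σ) ≡ σ) →
    count P m ≡ count Q n
  count-bij {P} {Q} {m} {n} f g forth back = begin
    length (selected P m)          ≡⟨ length-map f (selected P m) ⟨
    length (map f (selected P m))  ≡⟨ ↭-length (∼bag⇒↭ (unique∧set⇒bag f[L]-unique L′-unique same-elements)) ⟩
    length (selected Q n)          ∎
    where
    open ≡-Reasoning
    L L′ : List (List ℕ)
    L  = selected P m
    L′ = selected Q n
    L′-unique : Unique L′
    L′-unique = Unique.filter⁺ (λ π → T? (Q π)) (partitions-unique n)
    g∘f≡id : map g (map f L) ≡ L
    g∘f≡id = trans (sym (map-∘ L))
      (map-id-local (All.tabulate (λ π∈ → let π⊢ , Pπ = ∈-selected⁻ π∈ in proj₂ (proj₂ (forth π⊢ Pπ)))))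
    f[L]-unique : Unique (map f L)
    f[L]-unique = Unique.map⁻ (subst Unique (sym g∘f≡id)
                    (Unique.filter⁺ (λ π → T? (P π)) (partitions-unique m)))
    same-elements : ∀ {σ} → σ ∈ map f L ⇔ σ ∈ L′
    same-elements = mk⇔
      (λ σ∈ → let π , π∈ , σ≡ = ∈-map⁻ f σ∈
                  π⊢ , Pπ = ∈-selected⁻ π∈
                  fπ⊢ , Qfπ , _ = forth π⊢ Pπ
              in subst (_∈ L′) (sym σ≡) (∈-selected⁺ fπ⊢ Qfπ))
      (λ σ∈ → let σ⊢ , Qσ = ∈-selected⁻ σ∈
                  gσ⊢ , Pgσ , fgσ≡σ = back σ⊢ Qσ
              in subst (_∈ map f L) fgσ≡σ (∈-map⁺ f (∈-selected⁺ gσ⊢ Pgσ)))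

  count-cong : ∀ {P Q : List ℕ → Bool} {n} →
    (∀ {π} → π ⊢ n → T (P π) → T (Q π)) → (∀ {π} → π ⊢ n → T (Q π) → T (P π)) →
    count P n ≡ count Q n
  count-cong P⇒Q Q⇒P =
    count-bij id id (λ π⊢ Pπ → π⊢ , P⇒Q π⊢ Pπ , refl) (λ π⊢ Qπ → π⊢ , Q⇒P π⊢ Qπ , refl)

  count-none : ∀ {P n} → (∀ {π} → π ⊢ n → ¬ T (P π)) → count P n ≡ 0
  count-none {P} never =
    cong length (filter-none (λ π → T? (P π)) (All.tabulate (never ∘ ∈-partitions⁻)))

  count-split : ∀ (P R : List ℕ → Bool) n →
    count P n ≡ count (λ π → P π ∧ R π) n + count (λ π → P π ∧ not (R π)) n
  count-split P R n = go (partitions n)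
    where
    count′ : (List ℕ → Bool) → List (List ℕ) → ℕ
    count′ S xs = length (filter (λ π → T? (S π)) xs)
    go : ∀ xs → count′ P xs ≡ count′ (λ π → P π ∧ R π) xs + count′ (λ π → P π ∧ not (R π)) xs
    go []       = refl
    go (x ∷ xs) with P x | R x
    ... | true  | true  = cong suc (go xs)
    ... | true  | false = trans (cong suc (go xs)) (sym (+-suc _ _))
    ... | false | _     = go xs

count-cong-≡ : ∀ {P Q : List ℕ → Bool} {n} → (∀ {π} → π ⊢ n → P π ≡ Q π) → count P n ≡ count Q n
count-cong-≡ P≡Q = count-cong (λ π⊢ → subst T (P≡Q π⊢)) (λ π⊢ → subst T (sym (P≡Q π⊢)))

sumRangeℕ : (ℕ → ℕ) → (start len : ℕ) → ℕ
sumRangeℕ f start zero      = 0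
sumRangeℕ f start (suc len) = f start + sumRangeℕ f (suc start) len

sumRangeℕ-cong : ∀ {f g : ℕ → ℕ} a l → (∀ m → a ≤ m → m < a + l → f m ≡ g m) → sumRangeℕ f a l ≡ sumRangeℕ g a l
sumRangeℕ-cong a zero    _  = refl
sumRangeℕ-cong a (suc l) eq = cong₂ _+_ (eq a ≤-refl (m<m+n a (s≤s z≤n)))
  (sumRangeℕ-cong (suc a) l (λ m a<m m<a+l → eq m (<⇒≤ a<m) (subst (m <_) (sym (+-suc a l)) m<a+l)))

sumRangeℕ-last : ∀ f a l → sumRangeℕ f a (suc l) ≡ sumRangeℕ f a l + f (a + l)
sumRangeℕ-last f a zero    = trans (+-identityʳ (f a)) (cong f (sym (+-identityʳ a)))
sumRangeℕ-last f a (suc l) = trans (cong (f a +_) (sumRangeℕ-last f (suc a) l))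
  (trans (sym (+-assoc (f a) _ _)) (cong (λ m → f a + sumRangeℕ f (suc a) l + f m) (sym (+-suc a l))))

count-fibres : ∀ (P : List ℕ → Bool) (s : List ℕ → ℕ) a l n →
  (∀ {π} → π ⊢ n → T (P π) → a ≤ s π × s π < a + l) →
  count P n ≡ sumRangeℕ (λ m → count (λ π → P π ∧ (s π ≡ᵇ m)) n) a l
count-fibres P s a zero n bounds =
  count-none (λ π⊢ Pπ → let a≤s , s<a+0 = bounds π⊢ Pπ in <⇒≱ s<a+0 (≤-trans (≤-reflexive (+-identityʳ a)) a≤s))
count-fibres P s a (suc l) n bounds = begin
  count P n
    ≡⟨ count-split P (λ π → s π ≡ᵇ a) n ⟩
  count (λ π → P π ∧ (s π ≡ᵇ a)) n + count P′ n
    ≡⟨ cong (_ +_) (count-fibres P′ s (suc a) l n bounds′) ⟩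
  count (λ π → P π ∧ (s π ≡ᵇ a)) n + sumRangeℕ (λ m → count (λ π → P′ π ∧ (s π ≡ᵇ m)) n) (suc a) l
    ≡⟨ cong (_ +_) (sumRangeℕ-cong (suc a) l (λ m a<m _ → count-cong (λ _ → proj₂-fibre) (λ _ → fibre⇒P′ a<m))) ⟩
  sumRangeℕ (λ m → count (λ π → P π ∧ (s π ≡ᵇ m)) n) a (suc l) ∎
  where
  open ≡-Reasoning
  P′ : List ℕ → Bool
  P′ π = P π ∧ not (s π ≡ᵇ a)
  bounds′ : ∀ {π} → π ⊢ n → T (P′ π) → suc a ≤ s π × s π < suc a + l
  bounds′ {π} π⊢ t =
    let Pπ , s≢a = ∧-elim {P π} t
        a≤s , s<a+1+l = bounds π⊢ Pπ
    in ≤∧≢⇒< a≤s (λ a≡s → T-not⁻ s≢a (≡⇒≡ᵇ _ a (sym a≡s))) , subst (s π <_) (+-suc a l) s<a+1+l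
  proj₂-fibre : ∀ {π m} → T (P′ π ∧ (s π ≡ᵇ m)) → T (P π ∧ (s π ≡ᵇ m))
  proj₂-fibre {π} {m} with P π | s π ≡ᵇ a | s π ≡ᵇ m
  ... | true | false | true = _
  fibre⇒P′ : ∀ {π m} → a < m → T (P π ∧ (s π ≡ᵇ m)) → T (P′ π ∧ (s π ≡ᵇ m))
  fibre⇒P′ {π} {m} a<m t = let Pπ , s≡m = ∧-elim {P π} t in
    ∧-intro {P′ π} (∧-intro {P π} Pπ (T-not⁺ λ s≡a →
      <⇒≢ a<m (trans (sym (≡ᵇ⇒≡ (s π) a s≡a)) (≡ᵇ⇒≡ (s π) m s≡m)))) s≡m

count-≤ᵇ : ∀ (s : List ℕ → ℕ) K n →
  count (λ π → s π ≤ᵇ K) n ≡ sumRangeℕ (λ k → count (λ π → s π ≡ᵇ k) n) 0 (suc K)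
count-≤ᵇ s K n =
  trans (count-fibres (λ π → s π ≤ᵇ K) s 0 (suc K) n (λ {π} _ s≤K → z≤n , s≤s (≤ᵇ⇒≤ (s π) K s≤K)))
        (sumRangeℕ-cong 0 (suc K) (λ k _ k<1+K → count-cong (λ _ → proj₂ ∘ ∧-elim) (λ {π} _ s≡k →
           ∧-intro (≤⇒≤ᵇ (≤-trans (≤-reflexive (≡ᵇ⇒≡ (s π) k s≡k)) (s≤s⁻¹ k<1+K))) s≡k)))

countB-++ : ∀ P xs ys → countB P (xs ++ ys) ≡ countB P xs + countB P ys
countB-++ P []       ys = refl
countB-++ P (x ∷ xs) ys with P x
... | true  = cong suc (countB-++ P xs ys)
... | false = countB-++ P xs ys

countB≤length : ∀ P xs → countB P xs ≤ length xs
countB≤length P []       = z≤n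
countB≤length P (x ∷ xs) with P x
... | true  = s≤s (countB≤length P xs)
... | false = m≤n⇒m≤1+n (countB≤length P xs)

countB-mono : ∀ {P Q : ℕ → Bool} xs → (∀ {x} → T (P x) → T (Q x)) → countB P xs ≤ countB Q xs
countB-mono []                 _   = z≤n
countB-mono {P} {Q} (x ∷ xs) P⇒Q with P x in Px | Q x in Qx
... | true  | true  = s≤s (countB-mono xs P⇒Q)
... | true  | false = ⊥-elim (false⇒¬T Qx (P⇒Q (true⇒T Px)))
... | false | true  = m≤n⇒m≤1+n (countB-mono xs P⇒Q)
... | false | false = countB-mono xs P⇒Q

ones : ℕ → List ℕ
ones d = replicate d 1

dropOnes : List ℕ → List ℕ
dropOnes []       = []
dropOnes (x ∷ xs) = if x ≡ᵇ 1 then dropOnes xs else x ∷ dropOnes xs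

partsAbove : ℕ → List ℕ → ℕ
partsAbove e = countB (λ x → not (x ≤ᵇ e))

ω-ones : ∀ d → ω (ones d) ≡ d
ω-ones zero    = refl
ω-ones (suc d) = cong suc (ω-ones d)

partsAbove-ones : ∀ {e} d → 1 ≤ e → partsAbove e (ones d) ≡ 0
partsAbove-ones         zero    _         = refl
partsAbove-ones {suc e} (suc d) 1≤e = partsAbove-ones d 1≤e

sum-ones : ∀ d → sum (ones d) ≡ d
sum-ones zero    = refl
sum-ones (suc d) = cong suc (sum-ones d)

dropOnes-ones : ∀ d → dropOnes (ones d) ≡ []
dropOnes-ones zero    = refl
dropOnes-ones (suc d) = dropOnes-ones d

dropOnes-++-ones : ∀ σ d → dropOnes (σ ++ ones d) ≡ dropOnes σ
dropOnes-++-ones []      d = dropOnes-ones d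
dropOnes-++-ones (x ∷ σ) d with x ≡ᵇ 1
... | true  = dropOnes-++-ones σ d
... | false = cong (x ∷_) (dropOnes-++-ones σ d)

dropOnes-id : ∀ σ → ω σ ≡ 0 → dropOnes σ ≡ σ
dropOnes-id []      _ = refl
dropOnes-id (x ∷ σ) ωσ≡0 with x ≡ᵇ 1
... | false = cong (x ∷_) (dropOnes-id σ ωσ≡0)

ω-dropOnes : ∀ π → ω (dropOnes π) ≡ 0
ω-dropOnes []      = refl
ω-dropOnes (x ∷ π) with x ≡ᵇ 1 in x≢1
... | true  = ω-dropOnes π
... | false rewrite x≢1 = ω-dropOnes π

partsAbove-dropOnes : ∀ {e} π → 1 ≤ e → partsAbove e (dropOnes π) ≡ partsAbove e π
partsAbove-dropOnes []      _ = refl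
partsAbove-dropOnes {e} (x ∷ π) 1≤e with x ≡ᵇ 1 in x≡ᵇ1
... | true with refl ← ≡ᵇ⇒≡ x 1 (true⇒T x≡ᵇ1) | suc _ ← e = partsAbove-dropOnes π 1≤e
... | false with not (x ≤ᵇ e)
...   | true  = cong suc (partsAbove-dropOnes π 1≤e)
...   | false = partsAbove-dropOnes π 1≤e

Parts≤-ones : ∀ {k} d → 1 ≤ k → Parts≤ k (ones d)
Parts≤-ones zero    _   = []
Parts≤-ones (suc d) 1≤k = cons ≤-refl 1≤k (Parts≤-ones d ≤-refl)

Parts≤-++-ones : ∀ {k σ} d → 1 ≤ k → Parts≤ k σ → Parts≤ k (σ ++ ones d)
Parts≤-++-ones d 1≤k []                = Parts≤-ones d 1≤k
Parts≤-++-ones d _   (cons 1≤x x≤k p) = cons 1≤x x≤k (Parts≤-++-ones d 1≤x p)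

Parts≤-dropOnes : ∀ {k π} → Parts≤ k π → Parts≤ k (dropOnes π)
Parts≤-dropOnes [] = []
Parts≤-dropOnes {π = x ∷ _} (cons 1≤x x≤k p) with x ≡ᵇ 1
... | true  = Parts≤-weaken x≤k (Parts≤-dropOnes p)
... | false = cons 1≤x x≤k (Parts≤-dropOnes p)

ones-only : ∀ {xs} → Parts≤ 1 xs → xs ≡ ones (length xs)
ones-only []                          = refl
ones-only (cons (s≤s z≤n) (s≤s z≤n) p) = cong (1 ∷_) (ones-only p)

dropOnes++ones : ∀ {k π} → Parts≤ k π → dropOnes π ++ ones (ω π) ≡ π
dropOnes++ones [] = refl
dropOnes++ones {π = x ∷ xs} (cons _ _ p) with x ≡ᵇ 1 in x≡ᵇ1
... | false = cong (x ∷_) (dropOnes++ones p)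
... | true with refl ← ≡ᵇ⇒≡ x 1 (true⇒T x≡ᵇ1) = begin
  dropOnes xs ++ ones (suc (ω xs))   ≡⟨ cong (λ ys → dropOnes ys ++ ones (suc (ω ys))) (ones-only p) ⟩
  dropOnes (ones ℓ) ++ ones (suc (ω (ones ℓ)))  ≡⟨ cong₂ (λ zs m → zs ++ ones (suc m)) (dropOnes-ones ℓ) (ω-ones ℓ) ⟩
  ones (suc ℓ)                       ≡⟨ cong (1 ∷_) (ones-only p) ⟨
  1 ∷ xs                             ∎
  where
  open ≡-Reasoning
  ℓ = length xs

ω-++-ones : ∀ σ d → ω (σ ++ ones d) ≡ ω σ + d
ω-++-ones σ d = trans (countB-++ _ σ (ones d)) (cong (ω σ +_) (ω-ones d))

partsAbove-++-ones : ∀ {e} σ d → 1 ≤ e → partsAbove e (σ ++ ones d) ≡ partsAbove e σ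
partsAbove-++-ones {e} σ d 1≤e =
  trans (countB-++ _ σ (ones d)) (trans (cong (partsAbove e σ +_) (partsAbove-ones d 1≤e)) (+-identityʳ _))

sum-++-ones : ∀ σ d → sum (σ ++ ones d) ≡ sum σ + d
sum-++-ones σ d = trans (sum-++ σ (ones d)) (cong (sum σ +_) (sum-ones d))

length-++-ones : ∀ σ d → length (σ ++ ones d) ≡ length σ + d
length-++-ones σ d = trans (length-++ σ) (cong (length σ +_) (length-replicate d))

length-dropOnes : ∀ {k π} → Parts≤ k π → length (dropOnes π) + ω π ≡ length π
length-dropOnes {π = π} p = trans (sym (length-++-ones (dropOnes π) (ω π))) (cong length (dropOnes++ones p))

partsAbove-cons-≤ : ∀ {e x} ρ → x ≤ e → partsAbove e (x ∷ ρ) ≡ partsAbove e ρ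
partsAbove-cons-≤ {e} {x} ρ x≤e with x ≤ᵇ e | ≤⇒≤ᵇ x≤e
... | true | _ = refl

partsAbove-cons-> : ∀ {e x} ρ → e < x → partsAbove e (x ∷ ρ) ≡ suc (partsAbove e ρ)
partsAbove-cons-> {e} {x} ρ e<x with x ≤ᵇ e in x≤ᵇe
... | false = refl
... | true  = ⊥-elim (<⇒≱ e<x (≤ᵇ⇒≤ x e (true⇒T x≤ᵇe)))

partsAbove-Parts≤ : ∀ {b e ρ} → Parts≤ b ρ → b ≤ e → partsAbove e ρ ≡ 0
partsAbove-Parts≤ []                 _   = refl
partsAbove-Parts≤ {ρ = _ ∷ ρ} (cons _ x≤b p) b≤e =
  trans (partsAbove-cons-≤ ρ (≤-trans x≤b b≤e)) (partsAbove-Parts≤ p (≤-trans x≤b b≤e))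

ω-cons : ∀ {x} ρ → 2 ≤ x → ω (x ∷ ρ) ≡ ω ρ
ω-cons ρ (s≤s (s≤s _)) = refl

partsAbove-1 : ∀ {k π} → Parts≤ k π → partsAbove 1 π ≡ length (dropOnes π)
partsAbove-1 [] = refl
partsAbove-1 (cons {suc zero} _ _ p)    = partsAbove-1 p
partsAbove-1 (cons {suc (suc _)} _ _ p) = cong suc (partsAbove-1 p)

partsAbove-suc≤ : ∀ e π → partsAbove (suc e) π ≤ partsAbove e π
partsAbove-suc≤ e π = countB-mono π λ {x} x≰1+e → T-not⁺ (T-not⁻ x≰1+e ∘ ≤⇒≤ᵇ ∘ m≤n⇒m≤1+n ∘ ≤ᵇ⇒≤ x e)

memB-1 : ∀ π → memB 1 π ≡ not (ω π ≡ᵇ 0)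
memB-1 []                  = refl
memB-1 (zero ∷ π)          = memB-1 π
memB-1 (suc zero ∷ π)      = refl
memB-1 (suc (suc _) ∷ π)   = memB-1 π

insert : ℕ → List ℕ → List ℕ
insert j []       = j ∷ []
insert j (x ∷ xs) = if x ≤ᵇ j then j ∷ x ∷ xs else x ∷ insert j xs

remove : ℕ → List ℕ → List ℕ
remove j []       = []
remove j (x ∷ xs) = if j ≡ᵇ x then xs else x ∷ remove j xs

sum-insert : ∀ j xs → sum (insert j xs) ≡ j + sum xs
sum-insert j []       = refl
sum-insert j (x ∷ xs) with x ≤ᵇ j
... | true  = refl
... | false = trans (cong (x +_) (sum-insert j xs)) (x∙yz≈y∙xz x j (sum xs))

length-insert : ∀ j xs → length (insert j xs) ≡ suc (length xs)
length-insert j []       = refl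
length-insert j (x ∷ xs) with x ≤ᵇ j
... | true  = refl
... | false = cong suc (length-insert j xs)

firstPart-insert : ∀ j xs → firstPart (insert j xs) ≡ firstPart xs ⊔ j
firstPart-insert j []       = refl
firstPart-insert j (x ∷ xs) with x ≤ᵇ j in x≤ᵇj
... | true  = sym (m≤n⇒m⊔n≡n (≤ᵇ⇒≤ x j (true⇒T x≤ᵇj)))
... | false = sym (m≥n⇒m⊔n≡m (<⇒≤ (≰⇒> (false⇒¬T x≤ᵇj ∘ ≤⇒≤ᵇ))))

memB-insert : ∀ y j xs → memB y (insert j xs) ≡ (y ≡ᵇ j) ∨ memB y xs
memB-insert y j []       = refl
memB-insert y j (x ∷ xs) with x ≤ᵇ j
... | true  = refl
... | false = begin
  (y ≡ᵇ x) ∨ memB y (insert j xs)   ≡⟨ cong ((y ≡ᵇ x) ∨_) (memB-insert y j xs) ⟩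
  (y ≡ᵇ x) ∨ ((y ≡ᵇ j) ∨ memB y xs) ≡⟨ ∨-assoc (y ≡ᵇ x) _ _ ⟨
  ((y ≡ᵇ x) ∨ (y ≡ᵇ j)) ∨ memB y xs ≡⟨ cong (_∨ memB y xs) (∨-comm (y ≡ᵇ x) _) ⟩
  ((y ≡ᵇ j) ∨ (y ≡ᵇ x)) ∨ memB y xs ≡⟨ ∨-assoc (y ≡ᵇ j) _ _ ⟩
  (y ≡ᵇ j) ∨ ((y ≡ᵇ x) ∨ memB y xs) ∎
  where open ≡-Reasoning

Parts≤-insert : ∀ {k σ j} → 1 ≤ j → j ≤ k → Parts≤ k σ → Parts≤ k (insert j σ)
Parts≤-insert 1≤j j≤k [] = cons 1≤j j≤k []
Parts≤-insert {σ = x ∷ _} {j} 1≤j j≤k (cons 1≤x x≤k p) with x ≤ᵇ j in x≤ᵇj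
... | true  = cons 1≤j j≤k (cons 1≤x (≤ᵇ⇒≤ x j (true⇒T x≤ᵇj)) p)
... | false = cons 1≤x x≤k (Parts≤-insert 1≤j (<⇒≤ (≰⇒> (false⇒¬T x≤ᵇj ∘ ≤⇒≤ᵇ))) p)

remove-insert : ∀ j xs → remove j (insert j xs) ≡ xs
remove-insert j [] with j ≡ᵇ j | ≡⇒≡ᵇ j j refl
... | true | _ = refl
remove-insert j (x ∷ xs) with x ≤ᵇ j in x≤ᵇj
... | true with j ≡ᵇ j | ≡⇒≡ᵇ j j refl
...   | true | _ = refl
remove-insert j (x ∷ xs) | false with j ≡ᵇ x in j≡ᵇx
... | true  = ⊥-elim (false⇒¬T x≤ᵇj (≤⇒≤ᵇ (≤-reflexive (sym (≡ᵇ⇒≡ j x (true⇒T j≡ᵇx))))))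
... | false = cong (x ∷_) (remove-insert j xs)

memB⇒≤ : ∀ {k π j} → Parts≤ k π → T (memB j π) → j ≤ k
memB⇒≤ {π = x ∷ _} {j} (cons _ x≤k p) j∈ with j ≡ᵇ x in j≡ᵇx
... | true  = ≤-trans (≤-reflexive (≡ᵇ⇒≡ j x (true⇒T j≡ᵇx))) x≤k
... | false = ≤-trans (memB⇒≤ p j∈) x≤k

insert-remove : ∀ {k π j} → Parts≤ k π → T (memB j π) → insert j (remove j π) ≡ π
insert-remove {π = x ∷ xs} {j} (cons _ _ p) j∈ with j ≡ᵇ x in j≡ᵇx
... | true with refl ← ≡ᵇ⇒≡ j x (true⇒T j≡ᵇx) = insert-larger p
  where
  insert-larger : ∀ {ys} → Parts≤ j ys → insert j ys ≡ j ∷ ys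
  insert-larger [] = refl
  insert-larger {y ∷ _} (cons _ y≤j _) with y ≤ᵇ j | ≤⇒≤ᵇ y≤j
  ... | true | _ = refl
... | false with x ≤ᵇ j in x≤ᵇj
...   | true  = ⊥-elim (false⇒¬T j≡ᵇx (≡⇒≡ᵇ j x (≤-antisym (memB⇒≤ p j∈) (≤ᵇ⇒≤ x j (true⇒T x≤ᵇj)))))
...   | false = cong (x ∷_) (insert-remove p j∈)

Parts≤-remove : ∀ {k π} j → Parts≤ k π → Parts≤ k (remove j π)
Parts≤-remove j [] = []
Parts≤-remove {π = x ∷ _} j (cons 1≤x x≤k p) with j ≡ᵇ x
... | true  = Parts≤-weaken x≤k p
... | false = cons 1≤x x≤k (Parts≤-remove j p)

sum-remove : ∀ {j} π → T (memB j π) → j + sum (remove j π) ≡ sum π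
sum-remove {j} (x ∷ xs) j∈ with j ≡ᵇ x in j≡ᵇx
... | true with refl ← ≡ᵇ⇒≡ j x (true⇒T j≡ᵇx) = refl
... | false = trans (x∙yz≈y∙xz j x _) (cong (x +_) (sum-remove xs j∈))

count-removeLargest : ∀ {c} M (P : List ℕ → Bool) → 1 ≤ c →
  count (λ π → (firstPart π ≡ᵇ c) ∧ P π) (c + M) ≡
  count (λ σ → (firstPart σ ≤ᵇ c) ∧ P (c ∷ σ)) M
count-removeLargest {c} M P 1≤c = count-bij (drop 1) (c ∷_) forth back
  where
  forth : ∀ {π} → π ⊢ c + M → T ((firstPart π ≡ᵇ c) ∧ P π) →
          drop 1 π ⊢ M × T ((firstPart (drop 1 π) ≤ᵇ c) ∧ P (c ∷ drop 1 π)) × c ∷ drop 1 π ≡ π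
  forth {[]} _ t with () ← <⇒≢ 1≤c (≡ᵇ⇒≡ 0 c (proj₁ (∧-elim t)))
  forth {x ∷ xs} (cons _ _ p , sum≡) t with refl ← ≡ᵇ⇒≡ x c (proj₁ (∧-elim t)) =
    ⊢-intro p (+-cancelˡ-≡ x _ _ sum≡) , ∧-intro (≤⇒≤ᵇ (firstPart≤ p)) (proj₂ (∧-elim t)) , refl
  back : ∀ {σ} → σ ⊢ M → T ((firstPart σ ≤ᵇ c) ∧ P (c ∷ σ)) →
         c ∷ σ ⊢ c + M × T ((c ≡ᵇ c) ∧ P (c ∷ σ)) × σ ≡ σ
  back {σ} (p , sum≡) t =
    (cons 1≤c (m≤m+n c M) (Parts≤-weaken (≤ᵇ⇒≤ _ c (proj₁ (∧-elim t))) (Parts≤-firstPart p)) , cong (c +_) sum≡) ,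
    ∧-intro (≡⇒≡ᵇ c c refl) (proj₂ (∧-elim t)) , refl

count-removeOnes : ∀ {d} N (P : List ℕ → Bool) → 1 ≤ d →
  count (λ π → (ω π ≡ᵇ d) ∧ P (dropOnes π)) (d + N) ≡
  count (λ σ → (ω σ ≡ᵇ 0) ∧ P σ) N
count-removeOnes {d} N P 1≤d = count-bij dropOnes (_++ ones d) forth back
  where
  forth : ∀ {π} → π ⊢ d + N → T ((ω π ≡ᵇ d) ∧ P (dropOnes π)) →
          dropOnes π ⊢ N × T ((ω (dropOnes π) ≡ᵇ 0) ∧ P (dropOnes π)) × dropOnes π ++ ones d ≡ π
  forth {π} (p , sum≡) t with refl ← ≡ᵇ⇒≡ (ω π) d (proj₁ (∧-elim t)) =
    ⊢-intro (Parts≤-dropOnes p)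
      (+-cancelʳ-≡ _ _ _ (trans (sym (sum-++-ones (dropOnes π) (ω π))) (trans (cong sum (dropOnes++ones p)) (trans sum≡ (+-comm d N))))) ,
    ∧-intro (≡⇒≡ᵇ _ 0 (ω-dropOnes π)) (proj₂ (∧-elim t)) ,
    dropOnes++ones p
  back : ∀ {σ} → σ ⊢ N → T ((ω σ ≡ᵇ 0) ∧ P σ) →
         σ ++ ones d ⊢ d + N × T ((ω (σ ++ ones d) ≡ᵇ d) ∧ P (dropOnes (σ ++ ones d))) × dropOnes (σ ++ ones d) ≡ σ
  back {σ} (p , sum≡) t =
    ⊢-intro (Parts≤-++-ones d (≤-trans 1≤d (m≤n+m d N)) (Parts≤-weaken (m≤m+n N d) p))
      (trans (sum-++-ones σ d) (trans (cong (_+ d) sum≡) (+-comm N d))) ,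
    ∧-intro (≡⇒≡ᵇ _ d (trans (ω-++-ones σ d) (cong (_+ d) ωσ≡0))) (subst (T ∘ P) (sym dropOnes-σ) (proj₂ (∧-elim t))) ,
    dropOnes-σ
    where
    ωσ≡0 = ≡ᵇ⇒≡ (ω σ) 0 (proj₁ (∧-elim t))
    dropOnes-σ : dropOnes (σ ++ ones d) ≡ σ
    dropOnes-σ = trans (dropOnes-++-ones σ d) (dropOnes-id σ ωσ≡0)

count-insert : ∀ {j} M (Q : List ℕ → Bool) → 1 ≤ j →
  count (λ π → memB j π ∧ Q π) (j + M) ≡ count (λ σ → Q (insert j σ)) M
count-insert {j} M Q 1≤j = count-bij (remove j) (insert j) forth back
  where
  forth : ∀ {π} → π ⊢ j + M → T (memB j π ∧ Q π) →
          remove j π ⊢ M × T (Q (insert j (remove j π))) × insert j (remove j π) ≡ π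
  forth {π} (p , sum≡) t =
    let j∈ , Qπ = ∧-elim t
        π≡ = insert-remove p j∈
    in ⊢-intro (Parts≤-remove j p) (+-cancelˡ-≡ j _ _ (trans (sum-remove π j∈) sum≡)) ,
       subst (T ∘ Q) (sym π≡) Qπ , π≡
  back : ∀ {σ} → σ ⊢ M → T (Q (insert j σ)) →
         insert j σ ⊢ j + M × T (memB j (insert j σ) ∧ Q (insert j σ)) × remove j (insert j σ) ≡ σ
  back {σ} (p , sum≡) Qσ =
    ⊢-intro (Parts≤-insert 1≤j (m≤m+n j M) (Parts≤-weaken (m≤n+m M j) p)) (trans (sum-insert j σ) (cong (j +_) sum≡)) ,
    ∧-intro j∈ Qσ , remove-insert j σ
    where
    j∈ : T (memB j (insert j σ))
    j∈ rewrite memB-insert j j σ with j ≡ᵇ j | ≡⇒≡ᵇ j j refl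
    ... | true | _ = _

Parts≤-map-suc : ∀ {k τ} → Parts≤ k τ → Parts≤ (suc k) (map suc τ)
Parts≤-map-suc []               = []
Parts≤-map-suc (cons _ x≤k p) = cons (s≤s z≤n) (s≤s x≤k) (Parts≤-map-suc p)

ω-map-suc : ∀ {k τ} → Parts≤ k τ → ω (map suc τ) ≡ 0
ω-map-suc []                    = refl
ω-map-suc (cons (s≤s z≤n) _ p) = ω-map-suc p

sum-map-suc : ∀ τ → sum (map suc τ) ≡ length τ + sum τ
sum-map-suc []      = refl
sum-map-suc (x ∷ τ) = cong suc (trans (cong (x +_) (sum-map-suc τ)) (x∙yz≈y∙xz x (length τ) (sum τ)))

Parts≤-map-pred : ∀ {k ρ} → Parts≤ k ρ → ω ρ ≡ 0 → Parts≤ (pred k) (map pred ρ)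
Parts≤-map-pred [] _ = []
Parts≤-map-pred (cons {suc (suc _)} _ x≤k p) ωρ≡0 = cons (s≤s z≤n) (pred-mono-≤ x≤k) (Parts≤-map-pred p ωρ≡0)
Parts≤-map-pred (cons {1} _ _ _) ()

length+sum-map-pred : ∀ {k ρ} → Parts≤ k ρ → length ρ + sum (map pred ρ) ≡ sum ρ
length+sum-map-pred [] = refl
length+sum-map-pred {ρ = suc x ∷ xs} (cons _ _ p) =
  cong suc (trans (x∙yz≈y∙xz (length xs) x _) (cong (x +_) (length+sum-map-pred p)))

map-suc-pred : ∀ {k ρ} → Parts≤ k ρ → map suc (map pred ρ) ≡ ρ
map-suc-pred []                    = refl
map-suc-pred (cons (s≤s z≤n) _ p) = cong (_ ∷_) (map-suc-pred p)

map-pred-suc : ∀ τ → map pred (map suc τ) ≡ τ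
map-pred-suc τ = trans (sym (map-∘ τ)) (map-id τ)

shrink : List ℕ → List ℕ
shrink π = map pred (dropOnes π)

grow : ℕ → List ℕ → List ℕ
grow K τ = map suc τ ++ ones (K ∸ length τ)

count-removeColumn : ∀ K M (P : List ℕ → Bool) →
  count (λ π → (length π ≡ᵇ K) ∧ P (shrink π)) (K + M) ≡
  count (λ τ → (length τ ≤ᵇ K) ∧ P τ) M
count-removeColumn K M P = count-bij shrink (grow K) forth back
  where
  forth : ∀ {π} → π ⊢ K + M → T ((length π ≡ᵇ K) ∧ P (shrink π)) →
          shrink π ⊢ M × T ((length (shrink π) ≤ᵇ K) ∧ P (shrink π)) × grow K (shrink π) ≡ π
  forth {π} (p , sum≡) t =
    ⊢-intro (Parts≤-map-pred (Parts≤-dropOnes p) (ω-dropOnes π)) (+-cancelˡ-≡ K _ _ sum-shrink) ,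
    ∧-intro (≤⇒≤ᵇ (subst (_≤ K) (sym length-shrink) (≤-trans (m≤m+n ℓ (ω π)) (≤-reflexive ℓ+ω≡K))))
            (proj₂ (∧-elim t)) ,
    (begin
      map suc (shrink π) ++ ones (K ∸ length (shrink π)) ≡⟨ cong₂ _++_ (map-suc-pred ρp) (cong (ones ∘ (K ∸_)) length-shrink) ⟩
      ρ ++ ones (K ∸ ℓ)                                  ≡⟨ cong (λ m → ρ ++ ones m) K∸ℓ≡ω ⟩
      ρ ++ ones (ω π)                                    ≡⟨ dropOnes++ones p ⟩
      π                                                  ∎)
    where
    open ≡-Reasoning
    ρ = dropOnes π
    ρp = Parts≤-dropOnes p
    ℓ = length ρ
    length-shrink : length (shrink π) ≡ ℓ
    length-shrink = length-map pred ρ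
    ℓ+ω≡K : ℓ + ω π ≡ K
    ℓ+ω≡K = trans (length-dropOnes p) (≡ᵇ⇒≡ (length π) K (proj₁ (∧-elim t)))
    K∸ℓ≡ω : K ∸ ℓ ≡ ω π
    K∸ℓ≡ω = trans (cong (_∸ ℓ) (sym ℓ+ω≡K)) (m+n∸m≡n ℓ (ω π))
    sum-shrink : K + sum (shrink π) ≡ K + M
    sum-shrink = begin
      K + sum (shrink π)              ≡⟨ cong (_+ sum (shrink π)) ℓ+ω≡K ⟨
      ℓ + ω π + sum (shrink π)        ≡⟨ xy∙z≈xz∙y ℓ (ω π) _ ⟩
      ℓ + sum (shrink π) + ω π        ≡⟨ cong (_+ ω π) (length+sum-map-pred ρp) ⟩
      sum ρ + ω π                     ≡⟨ sum-++-ones ρ (ω π) ⟨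
      sum (ρ ++ ones (ω π))           ≡⟨ cong sum (dropOnes++ones p) ⟩
      sum π                           ≡⟨ sum≡ ⟩
      K + M                           ∎
  back : ∀ {τ} → τ ⊢ M → T ((length τ ≤ᵇ K) ∧ P τ) →
         grow K τ ⊢ K + M × T ((length (grow K τ) ≡ᵇ K) ∧ P (shrink (grow K τ))) × shrink (grow K τ) ≡ τ
  back {τ} (p , sum≡) t =
    ⊢-intro (Parts≤-++-ones (K ∸ ℓ) (s≤s z≤n) (Parts≤-map-suc p)) sum-grow ,
    ∧-intro (≡⇒≡ᵇ _ K length-grow) (subst (T ∘ P) (sym shrink-grow) (proj₂ (∧-elim t))) ,
    shrink-grow
    where
    open ≡-Reasoning
    ℓ = length τ
    ℓ+[K∸ℓ]≡K : ℓ + (K ∸ ℓ) ≡ K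
    ℓ+[K∸ℓ]≡K = m+[n∸m]≡n (≤ᵇ⇒≤ ℓ K (proj₁ (∧-elim t)))
    length-grow : length (grow K τ) ≡ K
    length-grow = trans (length-++-ones (map suc τ) (K ∸ ℓ)) (trans (cong (_+ (K ∸ ℓ)) (length-map suc τ)) ℓ+[K∸ℓ]≡K)
    sum-grow : sum (grow K τ) ≡ K + M
    sum-grow = begin
      sum (map suc τ ++ ones (K ∸ ℓ))  ≡⟨ sum-++-ones (map suc τ) (K ∸ ℓ) ⟩
      sum (map suc τ) + (K ∸ ℓ)        ≡⟨ cong (_+ (K ∸ ℓ)) (sum-map-suc τ) ⟩
      ℓ + sum τ + (K ∸ ℓ)              ≡⟨ xy∙z≈xz∙y ℓ (sum τ) _ ⟩
      ℓ + (K ∸ ℓ) + sum τ              ≡⟨ cong₂ _+_ ℓ+[K∸ℓ]≡K sum≡ ⟩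
      K + M                            ∎
    shrink-grow : shrink (grow K τ) ≡ τ
    shrink-grow = begin
      map pred (dropOnes (map suc τ ++ ones (K ∸ ℓ)))  ≡⟨ cong (map pred) (dropOnes-++-ones (map suc τ) (K ∸ ℓ)) ⟩
      map pred (dropOnes (map suc τ))                 ≡⟨ cong (map pred) (dropOnes-id (map suc τ) (ω-map-suc p)) ⟩
      map pred (map suc τ)                            ≡⟨ map-pred-suc τ ⟩
      τ                                               ∎

-- raise k adds 1 to each of the first k parts, deletes the (k+1)-st part (which is d) and
-- appends d ones; lower undoes this. Lowered k and Raised k describe their domains.
module PartsAboveStep (e : ℕ) (1≤e : 1 ≤ e) where

  d : ℕ
  d = suc e

  data Lowered : ℕ → List ℕ → Set where
    here  : ∀ {ρ} → Parts≤ d ρ → ω ρ ≡ 0 → Lowered 0 (d ∷ ρ)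
    there : ∀ {k x ρ} → d ≤ x → Parts≤ x ρ → Lowered k ρ → Lowered (suc k) (x ∷ ρ)

  data Raised : ℕ → List ℕ → Set where
    here  : ∀ {π} → Parts≤ d π → ω π ≡ d → Raised 0 π
    there : ∀ {k x π} → d < x → Parts≤ x π → Raised k π → Raised (suc k) (x ∷ π)

  raise : ℕ → List ℕ → List ℕ
  raise zero    []      = []
  raise zero    (_ ∷ ρ) = ρ ++ ones d
  raise (suc k) []      = []
  raise (suc k) (x ∷ ρ) = suc x ∷ raise k ρ

  lower : ℕ → List ℕ → List ℕ
  lower zero    π       = d ∷ dropOnes π
  lower (suc k) []      = []
  lower (suc k) (x ∷ π) = pred x ∷ lower k π

  toLowered : ∀ {b} k ρ → Parts≤ b ρ → ω ρ ≡ 0 → partsAbove d ρ ≤ k → k < partsAbove e ρ → Lowered k ρ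
  toLowered k (x ∷ ρ) (cons 1≤x _ p) ωρ≡0 above≤k k<above with x ≤? e
  ... | yes x≤e = ⊥-elim (n≮0 (subst (k <_) (partsAbove-Parts≤ (cons 1≤x x≤e p) ≤-refl) k<above))
  ... | no x≰e = go k above≤k k<above
    where
    d≤x : d ≤ x
    d≤x = ≰⇒> x≰e
    ωρ≡0′ : ω ρ ≡ 0
    ωρ≡0′ = trans (sym (ω-cons ρ (≤-trans (s≤s 1≤e) d≤x))) ωρ≡0
    k<above′ : ∀ {k} → suc k < partsAbove e (x ∷ ρ) → k < partsAbove e ρ
    k<above′ k<above = s≤s⁻¹ (≤-trans k<above (≤-reflexive (partsAbove-cons-> ρ d≤x)))
    go : ∀ k → partsAbove d (x ∷ ρ) ≤ k → k < partsAbove e (x ∷ ρ) → Lowered k (x ∷ ρ)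
    go k above≤k k<above with x ≤? d
    go zero    _ _ | yes x≤d with refl ← ≤-antisym x≤d d≤x = here p ωρ≡0′
    go (suc k) _ k<above | yes x≤d with refl ← ≤-antisym x≤d d≤x =
      there d≤x p (toLowered k ρ p ωρ≡0′ (≤-trans (≤-reflexive (partsAbove-Parts≤ p ≤-refl)) z≤n) (k<above′ k<above))
    go zero    above≤0 _ | no x≰d with () ← ≤-trans (≤-reflexive (sym (partsAbove-cons-> ρ (≰⇒> x≰d)))) above≤0
    go (suc k) above≤k k<above | no x≰d =
      there d≤x p (toLowered k ρ p ωρ≡0′ (s≤s⁻¹ (≤-trans (≤-reflexive (sym (partsAbove-cons-> ρ (≰⇒> x≰d)))) above≤k))
                                          (k<above′ k<above))

  toRaised : ∀ {b} k π → Parts≤ b π → ω π ≡ d → partsAbove d π ≡ k → Raised k π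
  toRaised zero π p ωπ≡d above≡0 = here (Parts≤-weaken (firstPart≤partsAbove0 {π} above≡0) (Parts≤-firstPart p)) ωπ≡d
    where
    firstPart≤partsAbove0 : ∀ {π} → partsAbove d π ≡ 0 → firstPart π ≤ d
    firstPart≤partsAbove0 {[]} _ = z≤n
    firstPart≤partsAbove0 {x ∷ ρ} above≡0 with x ≤? d
    ... | yes x≤d = x≤d
    ... | no x≰d with () ← trans (sym (partsAbove-cons-> ρ (≰⇒> x≰d))) above≡0
  toRaised (suc k) (x ∷ ρ) (cons 1≤x _ p) ωπ≡d above≡1+k with x ≤? d
  ... | yes x≤d with () ← trans (sym above≡1+k) (partsAbove-Parts≤ (cons 1≤x x≤d p) ≤-refl)
  ... | no x≰d = there (≰⇒> x≰d) p (toRaised k ρ p (trans (sym (ω-cons ρ (≤-trans (s≤s 1≤e) (<⇒≤ (≰⇒> x≰d))))) ωπ≡d)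
                                   (suc-injective (trans (sym (partsAbove-cons-> ρ (≰⇒> x≰d))) above≡1+k)))

  private
    2≤d : 2 ≤ d
    2≤d = s≤s 1≤e

  Parts≤-raise : ∀ {b k ρ} → Lowered k ρ → Parts≤ b ρ → Parts≤ (suc b) (raise k ρ)
  Parts≤-raise (here _ _)    (cons _ d≤b p) = Parts≤-++-ones d (s≤s z≤n) (Parts≤-weaken (m≤n⇒m≤1+n d≤b) p)
  Parts≤-raise (there _ _ l) (cons _ x≤b p) = cons (s≤s z≤n) (s≤s x≤b) (Parts≤-raise l p)

  ω-raise : ∀ {k ρ} → Lowered k ρ → ω (raise k ρ) ≡ d
  ω-raise (here {ρ} _ ωρ≡0)     = trans (ω-++-ones ρ d) (cong (_+ d) ωρ≡0)
  ω-raise (there {k} {ρ = ρ} d≤x _ l) = trans (ω-cons (raise k ρ) (s≤s (≤-trans (s≤s z≤n) d≤x))) (ω-raise l)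

  partsAbove-raise : ∀ {k ρ} → Lowered k ρ → partsAbove d (raise k ρ) ≡ k
  partsAbove-raise (here {ρ} p _) = trans (partsAbove-++-ones ρ d (s≤s z≤n)) (partsAbove-Parts≤ p ≤-refl)
  partsAbove-raise (there {k} {ρ = ρ} d≤x _ l) = trans (partsAbove-cons-> (raise k ρ) (s≤s d≤x)) (cong suc (partsAbove-raise l))

  sum-raise : ∀ {k ρ} → Lowered k ρ → sum (raise k ρ) ≡ k + sum ρ
  sum-raise (here {ρ} _ _) = trans (sum-++-ones ρ d) (+-comm (sum ρ) d)
  sum-raise {suc k} (there {x = x} {ρ} _ _ l) = cong suc (trans (cong (x +_) (sum-raise l)) (x∙yz≈y∙xz x k (sum ρ)))

  lower-raise : ∀ {k ρ} → Lowered k ρ → lower k (raise k ρ) ≡ ρ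
  lower-raise (here {ρ} _ ωρ≡0) = cong (d ∷_) (trans (dropOnes-++-ones ρ d) (dropOnes-id ρ ωρ≡0))
  lower-raise (there _ _ l)     = cong (_ ∷_) (lower-raise l)

  Parts≤-lower : ∀ {b k π} → Raised k π → Parts≤ b π → d ≤ pred b → Parts≤ (pred b) (lower k π)
  Parts≤-lower (here p _) _ d≤b-1 = cons (s≤s z≤n) d≤b-1 (Parts≤-dropOnes p)
  Parts≤-lower (there (s≤s d≤x-1) _ r) (cons _ x≤b q) _ =
    cons (≤-trans (s≤s z≤n) d≤x-1) (pred-mono-≤ x≤b) (Parts≤-lower r q d≤x-1)

  ω-lower : ∀ {k π} → Raised k π → ω (lower k π) ≡ 0
  ω-lower (here {π} _ _)          = trans (ω-cons (dropOnes π) 2≤d) (ω-dropOnes π)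
  ω-lower (there {k} {π = π} (s≤s d≤x-1) _ r) = trans (ω-cons (lower k π) (≤-trans 2≤d d≤x-1)) (ω-lower r)

  partsAbove-lower≤ : ∀ {k π} → Raised k π → partsAbove d (lower k π) ≤ k
  partsAbove-lower≤ (here {π} p _) = ≤-reflexive (trans (partsAbove-cons-≤ (dropOnes π) ≤-refl)
                                                         (partsAbove-Parts≤ (Parts≤-dropOnes p) ≤-refl))
  partsAbove-lower≤ (there {k} {suc x-1} {π} _ _ r) with x-1 ≤? d
  ... | yes x-1≤d = ≤-trans (≤-reflexive (partsAbove-cons-≤ (lower k π) x-1≤d)) (m≤n⇒m≤1+n (partsAbove-lower≤ r))
  ... | no x-1≰d  = ≤-trans (≤-reflexive (partsAbove-cons-> (lower k π) (≰⇒> x-1≰d))) (s≤s (partsAbove-lower≤ r))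

  partsAbove-lower> : ∀ {k π} → Raised k π → k < partsAbove e (lower k π)
  partsAbove-lower> (here {π} _ _)          = ≤-trans (s≤s z≤n) (≤-reflexive (sym (partsAbove-cons-> (dropOnes π) ≤-refl)))
  partsAbove-lower> (there {k} {π = π} (s≤s d≤x-1) _ r) =
    ≤-trans (s≤s (partsAbove-lower> r)) (≤-reflexive (sym (partsAbove-cons-> (lower k π) d≤x-1)))

  sum-lower : ∀ {k π} → Raised k π → k + sum (lower k π) ≡ sum π
  sum-lower (here {π} p ωπ≡d) = begin
    d + sum (dropOnes π)           ≡⟨ +-comm d _ ⟩
    sum (dropOnes π) + d           ≡⟨ cong (sum (dropOnes π) +_) ωπ≡d ⟨
    sum (dropOnes π) + ω π         ≡⟨ sum-++-ones (dropOnes π) (ω π) ⟨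
    sum (dropOnes π ++ ones (ω π)) ≡⟨ cong sum (dropOnes++ones p) ⟩
    sum π                          ∎
    where open ≡-Reasoning
  sum-lower {suc k} (there {x = suc x-1} {π} _ _ r) =
    cong suc (trans (x∙yz≈y∙xz k x-1 _) (cong (x-1 +_) (sum-lower r)))

  raise-lower : ∀ {k π} → Raised k π → raise k (lower k π) ≡ π
  raise-lower (here {π} p ωπ≡d)         = trans (cong (λ m → dropOnes π ++ ones m) (sym ωπ≡d)) (dropOnes++ones p)
  raise-lower (there (s≤s _) _ r) = cong (_ ∷_) (raise-lower r)

  count-step : ∀ K N →
    count (λ ρ → ((ω ρ ≡ᵇ 0) ∧ (partsAbove d ρ ≤ᵇ K)) ∧ not (partsAbove e ρ ≤ᵇ K)) N ≡
    count (λ π → (ω π ≡ᵇ d) ∧ (partsAbove d π ≡ᵇ K)) (K + N)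
  count-step K N = count-bij (raise K) (lower K) forth back
    where
    forth : ∀ {ρ} → ρ ⊢ N → T (((ω ρ ≡ᵇ 0) ∧ (partsAbove d ρ ≤ᵇ K)) ∧ not (partsAbove e ρ ≤ᵇ K)) →
            raise K ρ ⊢ K + N × T ((ω (raise K ρ) ≡ᵇ d) ∧ (partsAbove d (raise K ρ) ≡ᵇ K)) × lower K (raise K ρ) ≡ ρ
    forth {ρ} (p , sum≡) t =
      let ωρ≡0∧above≤K , not-above≤K = ∧-elim t
          ωρ≡0 , above≤K = ∧-elim ωρ≡0∧above≤K
          l = toLowered K ρ p (≡ᵇ⇒≡ (ω ρ) 0 ωρ≡0) (≤ᵇ⇒≤ (partsAbove d ρ) K above≤K)
                        (≰⇒> (T-not⁻ not-above≤K ∘ ≤⇒≤ᵇ))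
      in ⊢-intro (Parts≤-raise l p) (trans (sum-raise l) (cong (K +_) sum≡)) ,
         ∧-intro (≡⇒≡ᵇ _ d (ω-raise l)) (≡⇒≡ᵇ _ K (partsAbove-raise l)) ,
         lower-raise l
    back : ∀ {π} → π ⊢ K + N → T ((ω π ≡ᵇ d) ∧ (partsAbove d π ≡ᵇ K)) →
           lower K π ⊢ N × T (((ω (lower K π) ≡ᵇ 0) ∧ (partsAbove d (lower K π) ≤ᵇ K)) ∧ not (partsAbove e (lower K π) ≤ᵇ K)) ×
           raise K (lower K π) ≡ π
    back {π} (p , sum≡) t =
      let ωπ≡d , above≡K = ∧-elim t
          r = toRaised K π p (≡ᵇ⇒≡ (ω π) d ωπ≡d) (≡ᵇ⇒≡ (partsAbove d π) K above≡K)
      in ⊢-intro (Parts≤-lower r (Parts≤-weaken (m≤n⇒m≤1+n (m≤n+m (K + N) d)) p) (m≤m+n d (K + N)))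
                 (+-cancelˡ-≡ K _ _ (trans (sum-lower r) sum≡)) ,
         ∧-intro (∧-intro (≡⇒≡ᵇ _ 0 (ω-lower r)) (≤⇒≤ᵇ (partsAbove-lower≤ r)))
                 (T-not⁺ (<⇒≱ (partsAbove-lower> r) ∘ ≤ᵇ⇒≤ _ K)) ,
         raise-lower r

length≡ᵇ0≡firstPart≡ᵇ0 : ∀ {k π} → Parts≤ k π → (length π ≡ᵇ 0) ≡ (firstPart π ≡ᵇ 0)
length≡ᵇ0≡firstPart≡ᵇ0 []                  = refl
length≡ᵇ0≡firstPart≡ᵇ0 (cons (s≤s _) _ _) = refl

-- Removing the first column of the partitions with exactly m parts, resp. the largest part of
-- those with largest part m, leaves the partitions of N − m with at most m parts, resp. with
-- largest part at most m; induction on N closes the argument.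
count-length≡firstPart : ∀ N m → count (λ π → length π ≡ᵇ m) N ≡ count (λ π → firstPart π ≡ᵇ m) N
count-length≡firstPart = <-rec _ step
  where
  step : ∀ N → (∀ {M} → M < N → ∀ m → count (λ π → length π ≡ᵇ m) M ≡ count (λ π → firstPart π ≡ᵇ m) M) →
         ∀ m → count (λ π → length π ≡ᵇ m) N ≡ count (λ π → firstPart π ≡ᵇ m) N
  step N rec zero = count-cong-≡ (length≡ᵇ0≡firstPart≡ᵇ0 ∘ proj₁)
  step N rec (suc m) with suc m ≤? N
  ... | no m≰N = trans (count-none (λ {π} (p , sum≡) ℓ≡ → m≰N (≤-trans (≤-reflexive (sym (≡ᵇ⇒≡ (length π) (suc m) ℓ≡)))
                                                                         (subst (length π ≤_) sum≡ (length≤sum p)))))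
                       (sym (count-none (λ {π} (_ , sum≡) f≡ → m≰N (≤-trans (≤-reflexive (sym (≡ᵇ⇒≡ (firstPart π) (suc m) f≡)))
                                                                           (subst (firstPart π ≤_) sum≡ (firstPart≤sum π))))))
  ... | yes m≤N with M , refl ← m≤n⇒∃[o]m+o≡n m≤N = begin
    count (λ π → length π ≡ᵇ suc m) (suc m + M)                   ≡⟨ count-cong-≡ (λ _ → sym (∧-identityʳ _)) ⟩
    count (λ π → (length π ≡ᵇ suc m) ∧ true) (suc m + M)          ≡⟨ count-removeColumn (suc m) M (λ _ → true) ⟩
    count (λ τ → (length τ ≤ᵇ suc m) ∧ true) M                    ≡⟨ count-cong-≡ (λ _ → ∧-identityʳ _) ⟩
    count (λ τ → length τ ≤ᵇ suc m) M                             ≡⟨ count-≤ᵇ length (suc m) M ⟩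
    sumRangeℕ (λ k → count (λ π → length π ≡ᵇ k) M) 0 (suc (suc m))    ≡⟨ sumRangeℕ-cong 0 (suc (suc m)) (λ k _ _ → rec M<N k) ⟩
    sumRangeℕ (λ k → count (λ π → firstPart π ≡ᵇ k) M) 0 (suc (suc m)) ≡⟨ count-≤ᵇ firstPart (suc m) M ⟨
    count (λ σ → firstPart σ ≤ᵇ suc m) M                          ≡⟨ count-cong-≡ (λ _ → sym (∧-identityʳ _)) ⟩
    count (λ σ → (firstPart σ ≤ᵇ suc m) ∧ true) M                 ≡⟨ count-removeLargest M (λ _ → true) (s≤s z≤n) ⟨
    count (λ π → (firstPart π ≡ᵇ suc m) ∧ true) (suc m + M)       ≡⟨ count-cong-≡ (λ _ → ∧-identityʳ _) ⟩
    count (λ π → firstPart π ≡ᵇ suc m) (suc m + M)                ∎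
    where
    open ≡-Reasoning
    M<N : M < suc m + M
    M<N = s≤s (m≤n+m M m)

count-length≤≡firstPart≤ : ∀ N K → count (λ π → length π ≤ᵇ K) N ≡ count (λ π → firstPart π ≤ᵇ K) N
count-length≤≡firstPart≤ N K =
  trans (count-≤ᵇ length K N)
        (trans (sumRangeℕ-cong 0 (suc K) (λ k _ _ → count-length≡firstPart N k)) (sym (count-≤ᵇ firstPart K N)))

module _ {K′ : ℕ} where
  private
    K = suc K′

  count-length≤-byOnes : ∀ N →
    count (λ π → length π ≤ᵇ K) (suc N) ≡
    count (λ ρ → (ω ρ ≡ᵇ 0) ∧ (partsAbove 1 ρ ≤ᵇ K)) (suc N) + count (λ σ → length σ ≤ᵇ K′) N
  count-length≤-byOnes N = begin
    count (λ π → length π ≤ᵇ K) (suc N)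
      ≡⟨ count-split _ (λ π → ω π ≡ᵇ 0) (suc N) ⟩
    count (λ π → (length π ≤ᵇ K) ∧ (ω π ≡ᵇ 0)) (suc N) + count (λ π → (length π ≤ᵇ K) ∧ not (ω π ≡ᵇ 0)) (suc N)
      ≡⟨ cong₂ _+_ (count-cong-≡ (noOnes ∘ proj₁)) (count-cong-≡ (λ {π} _ → trans (∧-comm (length π ≤ᵇ K) _) (cong (_∧ (length π ≤ᵇ K)) (sym (memB-1 π))))) ⟩
    count (λ ρ → (ω ρ ≡ᵇ 0) ∧ (partsAbove 1 ρ ≤ᵇ K)) (suc N) + count (λ π → memB 1 π ∧ (length π ≤ᵇ K)) (1 + N)
      ≡⟨ cong (A +_) (count-insert N _ ≤-refl) ⟩
    count (λ ρ → (ω ρ ≡ᵇ 0) ∧ (partsAbove 1 ρ ≤ᵇ K)) (suc N) + count (λ σ → length (insert 1 σ) ≤ᵇ K) N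
      ≡⟨ cong (A +_) (count-cong-≡ (λ {σ} _ → trans (cong (_≤ᵇ K) (length-insert 1 σ)) (suc≤ᵇsuc (length σ) K′))) ⟩
    count (λ ρ → (ω ρ ≡ᵇ 0) ∧ (partsAbove 1 ρ ≤ᵇ K)) (suc N) + count (λ σ → length σ ≤ᵇ K′) N ∎
    where
    open ≡-Reasoning
    A = count (λ ρ → (ω ρ ≡ᵇ 0) ∧ (partsAbove 1 ρ ≤ᵇ K)) (suc N)
    noOnes : ∀ {π k} → Parts≤ k π → (length π ≤ᵇ K) ∧ (ω π ≡ᵇ 0) ≡ (ω π ≡ᵇ 0) ∧ (partsAbove 1 π ≤ᵇ K)
    noOnes {π} p with ω π | length-dropOnes p | partsAbove-1 p
    ... | zero  | ℓ+0≡ℓ | above≡ℓ = trans (∧-identityʳ _) (cong (_≤ᵇ K) (sym (trans above≡ℓ (trans (sym (+-identityʳ _)) ℓ+0≡ℓ))))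
    ... | suc _ | _     | _       = ∧-zeroʳ _

  count-firstPart≤-byOnes : ∀ N →
    count (λ π → firstPart π ≤ᵇ K) (suc N) ≡
    count (λ ρ → (ω ρ ≡ᵇ 0) ∧ (firstPart ρ ≤ᵇ K)) (suc N) + count (λ σ → firstPart σ ≤ᵇ K) N
  count-firstPart≤-byOnes N = begin
    count (λ π → firstPart π ≤ᵇ K) (suc N)
      ≡⟨ count-split _ (λ π → ω π ≡ᵇ 0) (suc N) ⟩
    count (λ π → (firstPart π ≤ᵇ K) ∧ (ω π ≡ᵇ 0)) (suc N) + count (λ π → (firstPart π ≤ᵇ K) ∧ not (ω π ≡ᵇ 0)) (suc N)
      ≡⟨ cong₂ _+_ (count-cong-≡ (λ {π} _ → ∧-comm (firstPart π ≤ᵇ K) _))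
                   (count-cong-≡ (λ {π} _ → trans (∧-comm (firstPart π ≤ᵇ K) _) (cong (_∧ (firstPart π ≤ᵇ K)) (sym (memB-1 π))))) ⟩
    B + count (λ π → memB 1 π ∧ (firstPart π ≤ᵇ K)) (1 + N)
      ≡⟨ cong (B +_) (count-insert N _ ≤-refl) ⟩
    B + count (λ σ → firstPart (insert 1 σ) ≤ᵇ K) N
      ≡⟨ cong (B +_) (count-cong-≡ (firstPart-insert-1 ∘ proj₁)) ⟩
    B + count (λ σ → firstPart σ ≤ᵇ K) N ∎
    where
    open ≡-Reasoning
    B = count (λ ρ → (ω ρ ≡ᵇ 0) ∧ (firstPart ρ ≤ᵇ K)) (suc N)
    firstPart-insert-1 : ∀ {k σ} → Parts≤ k σ → (firstPart (insert 1 σ) ≤ᵇ K) ≡ (firstPart σ ≤ᵇ K)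
    firstPart-insert-1 []                           = refl
    firstPart-insert-1 {σ = σ@(_ ∷ _)} (cons 1≤x _ _) = cong (_≤ᵇ K) (trans (firstPart-insert 1 σ) (m≥n⇒m⊔n≡m 1≤x))

  count-singleOne : ∀ N →
    count (λ π → (ω π ≡ᵇ 1) ∧ (partsAbove 1 π ≡ᵇ K)) (K + suc N) ≡ count (λ τ → length τ ≡ᵇ K) N
  count-singleOne N = begin
    count (λ π → (ω π ≡ᵇ 1) ∧ (partsAbove 1 π ≡ᵇ K)) (K + suc N)
      ≡⟨ cong (count (λ π → (ω π ≡ᵇ 1) ∧ (partsAbove 1 π ≡ᵇ K))) (+-suc K N) ⟩
    count (λ π → (ω π ≡ᵇ 1) ∧ (partsAbove 1 π ≡ᵇ K)) (1 + (K + N))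
      ≡⟨ count-cong-≡ (λ {π} _ → cong (λ m → (ω π ≡ᵇ 1) ∧ (m ≡ᵇ K)) (sym (partsAbove-dropOnes π ≤-refl))) ⟩
    count (λ π → (ω π ≡ᵇ 1) ∧ (partsAbove 1 (dropOnes π) ≡ᵇ K)) (1 + (K + N))
      ≡⟨ count-removeOnes (K + N) (λ σ → partsAbove 1 σ ≡ᵇ K) ≤-refl ⟩
    count (λ σ → (ω σ ≡ᵇ 0) ∧ (partsAbove 1 σ ≡ᵇ K)) (K + N)
      ≡⟨ count-cong (noOnes⇒ ∘ proj₁) (⇒noOnes ∘ proj₁) ⟩
    count (λ π → (length π ≡ᵇ K) ∧ (length (shrink π) ≡ᵇ K)) (K + N)
      ≡⟨ count-removeColumn K N (λ τ → length τ ≡ᵇ K) ⟩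
    count (λ τ → (length τ ≤ᵇ K) ∧ (length τ ≡ᵇ K)) N
      ≡⟨ count-cong (λ _ → proj₂ ∘ ∧-elim) (λ {τ} _ ℓ≡K → ∧-intro (≤⇒≤ᵇ (≤-reflexive (≡ᵇ⇒≡ (length τ) K ℓ≡K))) ℓ≡K) ⟩
    count (λ τ → length τ ≡ᵇ K) N ∎
    where
    open ≡-Reasoning
    noOnes⇒ : ∀ {k σ} → Parts≤ k σ → T ((ω σ ≡ᵇ 0) ∧ (partsAbove 1 σ ≡ᵇ K)) → T ((length σ ≡ᵇ K) ∧ (length (shrink σ) ≡ᵇ K))
    noOnes⇒ {σ = σ} p t =
      let ω≡0 , above≡K = ∧-elim {ω σ ≡ᵇ 0} t
          ℓ≡K = trans (sym (partsAbove-1 p)) (≡ᵇ⇒≡ (partsAbove 1 σ) K above≡K)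
      in ∧-intro (≡⇒≡ᵇ (length σ) K (trans (sym (length-dropOnes p)) (trans (cong (length (dropOnes σ) +_) (≡ᵇ⇒≡ (ω σ) 0 ω≡0)) (trans (+-identityʳ _) ℓ≡K))))
                 (≡⇒≡ᵇ (length (shrink σ)) K (trans (length-map pred (dropOnes σ)) ℓ≡K))
    ⇒noOnes : ∀ {k σ} → Parts≤ k σ → T ((length σ ≡ᵇ K) ∧ (length (shrink σ) ≡ᵇ K)) → T ((ω σ ≡ᵇ 0) ∧ (partsAbove 1 σ ≡ᵇ K))
    ⇒noOnes {σ = σ} p t =
      let length≡K , shrink≡K = ∧-elim {length σ ≡ᵇ K} t
          ℓ≡K = trans (sym (length-map pred (dropOnes σ))) (≡ᵇ⇒≡ (length (shrink σ)) K shrink≡K)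
          ℓ+ω≡ℓ+0 = trans (length-dropOnes p) (trans (≡ᵇ⇒≡ (length σ) K length≡K) (trans (sym ℓ≡K) (sym (+-identityʳ _))))
      in ∧-intro (≡⇒≡ᵇ (ω σ) 0 (+-cancelˡ-≡ (length (dropOnes σ)) _ _ ℓ+ω≡ℓ+0))
                 (≡⇒≡ᵇ (partsAbove 1 σ) K (trans (partsAbove-1 p) ℓ≡K))

  -- Compare the conjugation identity at N + 1 and at N, after removing one part 1 from the
  -- partitions of N + 1 that have one.
  count-noOnes-partsAbove1≤ : ∀ N →
    count (λ ρ → (ω ρ ≡ᵇ 0) ∧ (partsAbove 1 ρ ≤ᵇ K)) N ≡
    count (λ ρ → (ω ρ ≡ᵇ 0) ∧ (firstPart ρ ≤ᵇ K)) N + count (λ π → (ω π ≡ᵇ 1) ∧ (partsAbove 1 π ≡ᵇ K)) (K + N)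
  count-noOnes-partsAbove1≤ zero =
    trans (count-cong-≡ λ { ([] , _) → refl ; (cons (s≤s _) _ _ , ()) })
          (sym (trans (cong (count (λ ρ → (ω ρ ≡ᵇ 0) ∧ (firstPart ρ ≤ᵇ K)) 0 +_) (count-none tooLong)) (+-identityʳ _)))
    where
    tooLong : ∀ {π} → π ⊢ K + 0 → ¬ T ((ω π ≡ᵇ 1) ∧ (partsAbove 1 π ≡ᵇ K))
    tooLong {π} (p , sum≡) t =
      let ω≡1 , above≡K = ∧-elim {ω π ≡ᵇ 1} t in
      <⇒≱ (+-monoʳ-< K (s≤s z≤n)) (begin
        K + 1                           ≡⟨ cong₂ _+_ (trans (sym (≡ᵇ⇒≡ (partsAbove 1 π) K above≡K)) (partsAbove-1 p)) (sym (≡ᵇ⇒≡ (ω π) 1 ω≡1)) ⟩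
        length (dropOnes π) + ω π       ≡⟨ length-dropOnes p ⟩
        length π                        ≤⟨ length≤sum p ⟩
        sum π                           ≡⟨ sum≡ ⟩
        K + 0                           ∎)
      where open ≤-Reasoning
  count-noOnes-partsAbove1≤ (suc N) = +-cancelʳ-≡ _ _ _ (begin
    A + Q N K′                 ≡⟨ count-length≤-byOnes N ⟨
    Q (suc N) K                ≡⟨ count-length≤≡firstPart≤ (suc N) K ⟩
    R (suc N) K                ≡⟨ count-firstPart≤-byOnes N ⟩
    B + R N K                  ≡⟨ cong (B +_) (count-length≤≡firstPart≤ N K) ⟨
    B + Q N K                  ≡⟨ cong (B +_) (count-≤ᵇ length K N) ⟩
    B + sumRangeℕ (λ k → count (λ π → length π ≡ᵇ k) N) 0 (suc K)   ≡⟨ cong (B +_) (sumRangeℕ-last (λ k → count (λ π → length π ≡ᵇ k) N) 0 K) ⟩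
    B + (sumRangeℕ (λ k → count (λ π → length π ≡ᵇ k) N) 0 K + count (λ π → length π ≡ᵇ K) N)
                               ≡⟨ cong (λ x → B + (x + count (λ π → length π ≡ᵇ K) N)) (count-≤ᵇ length K′ N) ⟨
    B + (Q N K′ + count (λ π → length π ≡ᵇ K) N) ≡⟨ cong (λ x → B + (Q N K′ + x)) (count-singleOne N) ⟨
    B + (Q N K′ + H)           ≡⟨ cong (B +_) (+-comm (Q N K′) H) ⟩
    B + (H + Q N K′)           ≡⟨ +-assoc B H _ ⟨
    B + H + Q N K′             ∎)
    where
    open ≡-Reasoning
    Q R : ℕ → ℕ → ℕ
    Q n k = count (λ π → length π ≤ᵇ k) n
    R n k = count (λ π → firstPart π ≤ᵇ k) n
    A = count (λ ρ → (ω ρ ≡ᵇ 0) ∧ (partsAbove 1 ρ ≤ᵇ K)) (suc N)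
    B = count (λ ρ → (ω ρ ≡ᵇ 0) ∧ (firstPart ρ ≤ᵇ K)) (suc N)
    H = count (λ π → (ω π ≡ᵇ 1) ∧ (partsAbove 1 π ≡ᵇ K)) (K + suc N)

count-noOnes-partsAbove≤ : ∀ N {K} d → 1 ≤ K → 1 ≤ d →
  count (λ ρ → (ω ρ ≡ᵇ 0) ∧ (partsAbove d ρ ≤ᵇ K)) N ≡
  count (λ ρ → (ω ρ ≡ᵇ 0) ∧ (firstPart ρ ≤ᵇ K)) N +
  sumRangeℕ (λ w → count (λ π → (ω π ≡ᵇ w) ∧ (partsAbove w π ≡ᵇ K)) (K + N)) 1 d
count-noOnes-partsAbove≤ N {suc K′} 1 _ _ =
  trans (count-noOnes-partsAbove1≤ N) (cong (G +_) (sym (+-identityʳ _)))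
  where G = count (λ ρ → (ω ρ ≡ᵇ 0) ∧ (firstPart ρ ≤ᵇ suc K′)) N
count-noOnes-partsAbove≤ N {K} (suc e@(suc _)) 1≤K _ = begin
  count (λ ρ → (ω ρ ≡ᵇ 0) ∧ (partsAbove (suc e) ρ ≤ᵇ K)) N
    ≡⟨ count-split _ (λ ρ → partsAbove e ρ ≤ᵇ K) N ⟩
  count (λ ρ → ((ω ρ ≡ᵇ 0) ∧ (partsAbove (suc e) ρ ≤ᵇ K)) ∧ (partsAbove e ρ ≤ᵇ K)) N +
  count (λ ρ → ((ω ρ ≡ᵇ 0) ∧ (partsAbove (suc e) ρ ≤ᵇ K)) ∧ not (partsAbove e ρ ≤ᵇ K)) N
    ≡⟨ cong₂ _+_ (count-cong (λ {ρ} _ → drop-middle {ρ}) (λ {ρ} _ → add-middle {ρ})) (PartsAboveStep.count-step e (s≤s z≤n) K N) ⟩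
  count (λ ρ → (ω ρ ≡ᵇ 0) ∧ (partsAbove e ρ ≤ᵇ K)) N + h (suc e)
    ≡⟨ cong (_+ h (suc e)) (count-noOnes-partsAbove≤ N e 1≤K (s≤s z≤n)) ⟩
  G + sumRangeℕ h 1 e + h (suc e)
    ≡⟨ +-assoc G _ _ ⟩
  G + (sumRangeℕ h 1 e + h (suc e))
    ≡⟨ cong (G +_) (sumRangeℕ-last h 1 e) ⟨
  G + sumRangeℕ h 1 (suc e) ∎
  where
  open ≡-Reasoning
  G = count (λ ρ → (ω ρ ≡ᵇ 0) ∧ (firstPart ρ ≤ᵇ K)) N
  h : ℕ → ℕ
  h w = count (λ π → (ω π ≡ᵇ w) ∧ (partsAbove w π ≡ᵇ K)) (K + N)
  drop-middle : ∀ {ρ} → T (((ω ρ ≡ᵇ 0) ∧ (partsAbove (suc e) ρ ≤ᵇ K)) ∧ (partsAbove e ρ ≤ᵇ K)) → T ((ω ρ ≡ᵇ 0) ∧ (partsAbove e ρ ≤ᵇ K))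
  drop-middle {ρ} with ω ρ ≡ᵇ 0 | partsAbove (suc e) ρ ≤ᵇ K | partsAbove e ρ ≤ᵇ K
  ... | true | true | true = _
  add-middle : ∀ {ρ} → T ((ω ρ ≡ᵇ 0) ∧ (partsAbove e ρ ≤ᵇ K)) → T (((ω ρ ≡ᵇ 0) ∧ (partsAbove (suc e) ρ ≤ᵇ K)) ∧ (partsAbove e ρ ≤ᵇ K))
  add-middle {ρ} t =
    let ω≡0 , above≤K = ∧-elim {ω ρ ≡ᵇ 0} t in
    ∧-intro (∧-intro ω≡0 (≤⇒≤ᵇ (≤-trans (partsAbove-suc≤ e ρ) (≤ᵇ⇒≤ (partsAbove e ρ) K above≤K)))) above≤K

-- For w = ω π, crank π = crankMinuend w π − w (crank≡minuend-ω).
crankMinuend : ℕ → List ℕ → ℕ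
crankMinuend zero    π = firstPart π
crankMinuend (suc w) π = partsAbove (suc w) π

crankGe crankLe : ℕ → List ℕ → Bool
crankGe j π = ω π + j ≤ᵇ crankMinuend (ω π) π
crankLe j π = crankMinuend (ω π) π ≤ᵇ ω π + j

crankMinuend≤sum : ∀ {k} w π → Parts≤ k π → crankMinuend w π ≤ sum π
crankMinuend≤sum zero    π _ = firstPart≤sum π
crankMinuend≤sum (suc w) π p = ≤-trans (countB≤length _ π) (length≤sum p)

ω≤sum : ∀ {k π} → Parts≤ k π → ω π ≤ sum π
ω≤sum {π = π} p = ≤-trans (countB≤length _ π) (length≤sum p)

crankGe-fibre⇒ : ∀ {j d} π → T (crankGe j π ∧ (crankMinuend (ω π) π ∸ j ≡ᵇ d)) →
                 T ((ω π ≤ᵇ d) ∧ (crankMinuend (ω π) π ≡ᵇ j + d))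
crankGe-fibre⇒ {j} {d} π t =
  let ω+j≤c , c∸j≡d = ∧-elim {ω π + j ≤ᵇ c} t
      ω+j≤c′ = ≤ᵇ⇒≤ (ω π + j) c ω+j≤c
      c≡j+d = trans (sym (m+[n∸m]≡n (m+n≤o⇒n≤o (ω π) ω+j≤c′))) (cong (j +_) (≡ᵇ⇒≡ (c ∸ j) d c∸j≡d))
  in ∧-intro (≤⇒≤ᵇ (+-cancelʳ-≤ j (ω π) d (subst (ω π + j ≤_) (trans c≡j+d (+-comm j d)) ω+j≤c′)))
             (≡⇒≡ᵇ c (j + d) c≡j+d)
  where c = crankMinuend (ω π) π

crankGe-fibre⇐ : ∀ {j d} π → T ((ω π ≤ᵇ d) ∧ (crankMinuend (ω π) π ≡ᵇ j + d)) →
                 T (crankGe j π ∧ (crankMinuend (ω π) π ∸ j ≡ᵇ d))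
crankGe-fibre⇐ {j} {d} π t =
  let ω≤d , c≡j+d = ∧-elim {ω π ≤ᵇ d} t
      c≡j+d′ = ≡ᵇ⇒≡ c (j + d) c≡j+d
  in ∧-intro (≤⇒≤ᵇ (subst (ω π + j ≤_) (trans (+-comm d j) (sym c≡j+d′)) (+-monoˡ-≤ j (≤ᵇ⇒≤ (ω π) d ω≤d))))
             (≡⇒≡ᵇ (c ∸ j) d (trans (cong (_∸ j) c≡j+d′) (m+n∸m≡n j d)))
  where c = crankMinuend (ω π) π

crankLe-fibre : ∀ j d π → crankLe j π ∧ (ω π ≡ᵇ d) ≡ (ω π ≡ᵇ d) ∧ (crankMinuend d π ≤ᵇ d + j)
crankLe-fibre j d π = trans (∧-comm (crankLe j π) _) (≡ᵇ-∧-subst (ω π) d (λ w → crankMinuend w π ≤ᵇ w + j))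

count-removeLargest-noOnes : ∀ c n → 1 ≤ c → 2 ≤ c + n →
  count (λ π → (firstPart π ≡ᵇ c) ∧ (ω π ≡ᵇ 0)) (c + n) ≡ count (λ σ → (firstPart σ ≤ᵇ c) ∧ (ω σ ≡ᵇ 0)) n
count-removeLargest-noOnes 1 n _ 2≤1+n =
  trans (count-none λ {π} (p , _) t → let first≡1 , ω≡0 = ∧-elim {firstPart π ≡ᵇ 1} t
                                     in firstPart≡1⇒ω≢0 p (≡ᵇ⇒≡ _ 1 first≡1) (≡ᵇ⇒≡ (ω π) 0 ω≡0))
        (sym (count-none λ {σ} (p , sum≡) t → let first≤1 , ω≡0 = ∧-elim {firstPart σ ≤ᵇ 1} t
                                             in firstPart≡1⇒ω≢0 p (≤-antisym (≤ᵇ⇒≤ _ 1 first≤1) (nonempty p sum≡)) (≡ᵇ⇒≡ (ω σ) 0 ω≡0)))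
  where
  firstPart≡1⇒ω≢0 : ∀ {k π} → Parts≤ k π → firstPart π ≡ 1 → ω π ≢ 0
  firstPart≡1⇒ω≢0 (cons {suc zero} _ _ _) _ ()
  nonempty : ∀ {k σ} → Parts≤ k σ → sum σ ≡ n → 1 ≤ firstPart σ
  nonempty []             refl = ≤-trans (s≤s z≤n) (s≤s⁻¹ 2≤1+n)
  nonempty (cons 1≤x _ _) _    = 1≤x
count-removeLargest-noOnes c@(suc (suc _)) n 1≤c _ =
  trans (count-removeLargest n (λ π → ω π ≡ᵇ 0) 1≤c)
        (count-cong-≡ (λ {σ} _ → cong (λ m → (firstPart σ ≤ᵇ c) ∧ (m ≡ᵇ 0)) (ω-cons {c} σ (s≤s (s≤s z≤n)))))

count-crankPiece-0 : ∀ j n → 1 ≤ j → 2 ≤ n + j →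
  count (λ π → crankGe j π ∧ (crankMinuend (ω π) π ∸ j ≡ᵇ 0)) (n + j) ≡ count (λ π → crankLe j π ∧ (ω π ≡ᵇ 0)) n
count-crankPiece-0 j n 1≤j 2≤n+j = begin
  count (λ π → crankGe j π ∧ (crankMinuend (ω π) π ∸ j ≡ᵇ 0)) (n + j)
    ≡⟨ count-cong (λ {π} _ → crankGe-fibre⇒ π) (λ {π} _ → crankGe-fibre⇐ π) ⟩
  count (λ π → (ω π ≤ᵇ 0) ∧ (crankMinuend (ω π) π ≡ᵇ j + 0)) (n + j)
    ≡⟨ count-cong-≡ (λ {π} _ → noOnes π) ⟩
  count (λ π → (firstPart π ≡ᵇ j) ∧ (ω π ≡ᵇ 0)) (n + j)
    ≡⟨ cong (count (λ π → (firstPart π ≡ᵇ j) ∧ (ω π ≡ᵇ 0))) (+-comm n j) ⟩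
  count (λ π → (firstPart π ≡ᵇ j) ∧ (ω π ≡ᵇ 0)) (j + n)
    ≡⟨ count-removeLargest-noOnes j n 1≤j (subst (2 ≤_) (+-comm n j) 2≤n+j) ⟩
  count (λ σ → (firstPart σ ≤ᵇ j) ∧ (ω σ ≡ᵇ 0)) n
    ≡⟨ count-cong-≡ (λ {π} _ → trans (∧-comm (firstPart π ≤ᵇ j) _) (sym (crankLe-fibre j 0 π))) ⟩
  count (λ π → crankLe j π ∧ (ω π ≡ᵇ 0)) n ∎
  where
  open ≡-Reasoning
  ≤ᵇ0 : ∀ m → (m ≤ᵇ 0) ≡ (m ≡ᵇ 0)
  ≤ᵇ0 zero    = refl
  ≤ᵇ0 (suc m) = refl
  noOnes : ∀ π → (ω π ≤ᵇ 0) ∧ (crankMinuend (ω π) π ≡ᵇ j + 0) ≡ (firstPart π ≡ᵇ j) ∧ (ω π ≡ᵇ 0)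
  noOnes π = begin
    (ω π ≤ᵇ 0) ∧ (crankMinuend (ω π) π ≡ᵇ j + 0) ≡⟨ cong₂ _∧_ (≤ᵇ0 (ω π)) (cong (crankMinuend (ω π) π ≡ᵇ_) (+-identityʳ j)) ⟩
    (ω π ≡ᵇ 0) ∧ (crankMinuend (ω π) π ≡ᵇ j)     ≡⟨ ≡ᵇ-∧-subst (ω π) 0 (λ w → crankMinuend w π ≡ᵇ j) ⟩
    (ω π ≡ᵇ 0) ∧ (firstPart π ≡ᵇ j)               ≡⟨ ∧-comm (ω π ≡ᵇ 0) _ ⟩
    (firstPart π ≡ᵇ j) ∧ (ω π ≡ᵇ 0)               ∎

count-crankPiece-suc : ∀ j n d → 1 ≤ j → 1 ≤ d → d ≤ n →
  count (λ π → crankGe j π ∧ (crankMinuend (ω π) π ∸ j ≡ᵇ d)) (n + j) ≡ count (λ π → crankLe j π ∧ (ω π ≡ᵇ d)) n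
count-crankPiece-suc j n d@(suc _) 1≤j _ d≤n with N , refl ← m≤n⇒∃[o]m+o≡n d≤n = begin
  count (λ π → crankGe j π ∧ (crankMinuend (ω π) π ∸ j ≡ᵇ d)) (d + N + j)
    ≡⟨ cong (count (λ π → crankGe j π ∧ (crankMinuend (ω π) π ∸ j ≡ᵇ d))) (trans (+-comm (d + N) j) (sym (+-assoc j d N))) ⟩
  count (λ π → crankGe j π ∧ (crankMinuend (ω π) π ∸ j ≡ᵇ d)) (K + N)
    ≡⟨ count-cong (λ {π} _ → crankGe-fibre⇒ π) (λ {π} _ → crankGe-fibre⇐ π) ⟩
  count (λ π → (ω π ≤ᵇ d) ∧ (crankMinuend (ω π) π ≡ᵇ K)) (K + N)
    ≡⟨ count-fibres _ ω 0 (suc d) (K + N) (λ {π} _ t → z≤n , s≤s (≤ᵇ⇒≤ (ω π) d (proj₁ (∧-elim {ω π ≤ᵇ d} t)))) ⟩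
  term 0 + sumRangeℕ term 1 d
    ≡⟨ cong₂ _+_ noOnesTerm (sumRangeℕ-cong 1 d onesTerm) ⟩
  G + sumRangeℕ h 1 d
    ≡⟨ count-noOnes-partsAbove≤ N d (≤-trans 1≤j (m≤m+n j d)) (s≤s z≤n) ⟨
  count (λ ρ → (ω ρ ≡ᵇ 0) ∧ (partsAbove d ρ ≤ᵇ K)) N
    ≡⟨ count-removeOnes N (λ ρ → partsAbove d ρ ≤ᵇ K) (s≤s z≤n) ⟨
  count (λ π → (ω π ≡ᵇ d) ∧ (partsAbove d (dropOnes π) ≤ᵇ K)) (d + N)
    ≡⟨ count-cong-≡ (λ {π} _ → cong₂ (λ a k → (ω π ≡ᵇ d) ∧ (a ≤ᵇ k)) (partsAbove-dropOnes π (s≤s z≤n)) (+-comm j d)) ⟩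
  count (λ π → (ω π ≡ᵇ d) ∧ (crankMinuend d π ≤ᵇ d + j)) (d + N)
    ≡⟨ count-cong-≡ (λ {π} _ → crankLe-fibre j d π) ⟨
  count (λ π → crankLe j π ∧ (ω π ≡ᵇ d)) (d + N) ∎
  where
  open ≡-Reasoning
  K = j + d
  G = count (λ ρ → (ω ρ ≡ᵇ 0) ∧ (firstPart ρ ≤ᵇ K)) N
  h term : ℕ → ℕ
  h w = count (λ π → (ω π ≡ᵇ w) ∧ (partsAbove w π ≡ᵇ K)) (K + N)
  term w = count (λ π → ((ω π ≤ᵇ d) ∧ (crankMinuend (ω π) π ≡ᵇ K)) ∧ (ω π ≡ᵇ w)) (K + N)
  fibre : ∀ π w → ((ω π ≤ᵇ d) ∧ (crankMinuend (ω π) π ≡ᵇ K)) ∧ (ω π ≡ᵇ w) ≡ (ω π ≡ᵇ w) ∧ ((w ≤ᵇ d) ∧ (crankMinuend w π ≡ᵇ K))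
  fibre π w = trans (∧-comm ((ω π ≤ᵇ d) ∧ _) _) (≡ᵇ-∧-subst (ω π) w (λ v → (v ≤ᵇ d) ∧ (crankMinuend v π ≡ᵇ K)))
  noOnesTerm : term 0 ≡ G
  noOnesTerm = begin
    term 0                                                   ≡⟨ count-cong-≡ (λ {π} _ → trans (fibre π 0) (∧-comm (ω π ≡ᵇ 0) _)) ⟩
    count (λ π → (firstPart π ≡ᵇ K) ∧ (ω π ≡ᵇ 0)) (K + N)   ≡⟨ count-removeLargest-noOnes K N (≤-trans 1≤j (m≤m+n j d)) 2≤K+N ⟩
    count (λ σ → (firstPart σ ≤ᵇ K) ∧ (ω σ ≡ᵇ 0)) N         ≡⟨ count-cong-≡ (λ {σ} _ → ∧-comm (firstPart σ ≤ᵇ K) _) ⟩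
    G                                                        ∎
    where
    2≤K+N : 2 ≤ K + N
    2≤K+N = ≤-trans (+-mono-≤ 1≤j (s≤s z≤n)) (m≤m+n K N)
  onesTerm : ∀ w → 1 ≤ w → w < 1 + d → term w ≡ h w
  onesTerm w@(suc _) _ w<1+d =
    count-cong-≡ (λ {π} _ → trans (fibre π w) (cong (λ b → (ω π ≡ᵇ w) ∧ (b ∧ (partsAbove w π ≡ᵇ K))) (T⇒true (≤⇒≤ᵇ (s≤s⁻¹ w<1+d)))))

-- Slice d of the left side (crank minuend = j + d) has as many elements as slice d of the
-- right side (d ones).
count-crankGe-shift : ∀ {j} n → 1 ≤ j → 2 ≤ n + j → count (crankGe j) (n + j) ≡ count (crankLe j) n
count-crankGe-shift {j} n 1≤j 2≤n+j = begin
  count (crankGe j) (n + j)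
    ≡⟨ count-fibres (crankGe j) (λ π → crankMinuend (ω π) π ∸ j) 0 (suc n) (n + j) bounds-left ⟩
  sumRangeℕ (λ d → count (λ π → crankGe j π ∧ (crankMinuend (ω π) π ∸ j ≡ᵇ d)) (n + j)) 0 (suc n)
    ≡⟨ sumRangeℕ-cong 0 (suc n) piece ⟩
  sumRangeℕ (λ d → count (λ π → crankLe j π ∧ (ω π ≡ᵇ d)) n) 0 (suc n)
    ≡⟨ count-fibres (crankLe j) ω 0 (suc n) n (λ {π} (p , sum≡) _ → z≤n , s≤s (subst (ω π ≤_) sum≡ (ω≤sum p))) ⟨
  count (crankLe j) n ∎
  where
  open ≡-Reasoning
  bounds-left : ∀ {π} → π ⊢ n + j → T (crankGe j π) → 0 ≤ crankMinuend (ω π) π ∸ j × crankMinuend (ω π) π ∸ j < suc n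
  bounds-left {π} (p , sum≡) _ =
    z≤n , s≤s (≤-trans (∸-monoˡ-≤ j (subst (crankMinuend (ω π) π ≤_) sum≡ (crankMinuend≤sum (ω π) π p))) (≤-reflexive (m+n∸n≡m n j)))
  piece : ∀ d → 0 ≤ d → d < suc n →
    count (λ π → crankGe j π ∧ (crankMinuend (ω π) π ∸ j ≡ᵇ d)) (n + j) ≡ count (λ π → crankLe j π ∧ (ω π ≡ᵇ d)) n
  piece zero    _ _       = count-crankPiece-0 j n 1≤j 2≤n+j
  piece (suc d) _ d<1+n = count-crankPiece-suc j n (suc d) 1≤j (s≤s z≤n) (s≤s⁻¹ d<1+n)

count-crankGe-small : ∀ j n → n < j → count (crankGe j) n ≡ 0
count-crankGe-small j n n<j = count-none λ {π} (p , sum≡) t →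
  <⇒≱ n<j (begin
    j                         ≤⟨ m≤n+m j (ω π) ⟩
    ω π + j                   ≤⟨ ≤ᵇ⇒≤ (ω π + j) _ t ⟩
    crankMinuend (ω π) π      ≤⟨ crankMinuend≤sum (ω π) π p ⟩
    sum π                     ≡⟨ sum≡ ⟩
    n                         ∎)
  where open ≤-Reasoning

-- Σ_{m≥j} M(m,n) as a natural number; the clause for j = n = 1 is the convention M(1,1) = 1
-- (the partition 1 itself has crank −1).
crankGeCount : ℕ → ℕ → ℕ
crankGeCount j n@(suc (suc _)) = count (crankGe j) n
crankGeCount 1 1               = 1
crankGeCount j n               = count (crankGe j) n

crankGeCount-≥2 : ∀ j n → crankGeCount (suc (suc j)) n ≡ count (crankGe (suc (suc j))) n
crankGeCount-≥2 j zero          = refl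
crankGeCount-≥2 j (suc zero)    = refl
crankGeCount-≥2 j (suc (suc n)) = refl

count-crankGe-rec : ∀ j M → 1 ≤ j → 2 ≤ M + j →
  count (crankGe j) (j + M) + count (crankGe (suc j)) M ≡ count (λ _ → true) M
count-crankGe-rec j M 1≤j 2≤M+j = begin
  count (crankGe j) (j + M) + next
    ≡⟨ cong (_+ next) (trans (cong (count (crankGe j)) (+-comm j M)) (count-crankGe-shift M 1≤j 2≤M+j)) ⟩
  count (crankLe j) M + next
    ≡⟨ cong (count (crankLe j) M +_) (count-cong (λ {π} _ → ge⇒not-le π) (λ {π} _ → not-le⇒ge π)) ⟩
  count (crankLe j) M + count (λ π → not (crankLe j π)) M
    ≡⟨ count-split (λ _ → true) (crankLe j) M ⟨
  count (λ _ → true) M ∎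
  where
  open ≡-Reasoning
  next = count (crankGe (suc j)) M
  ge⇒not-le : ∀ π → T (crankGe (suc j) π) → T (not (crankLe j π))
  ge⇒not-le π ge = T-not⁺ λ le →
    <⇒≱ (subst (_≤ crankMinuend (ω π) π) (+-suc (ω π) j) (≤ᵇ⇒≤ _ _ ge)) (≤ᵇ⇒≤ (crankMinuend (ω π) π) _ le)
  not-le⇒ge : ∀ π → T (not (crankLe j π)) → T (crankGe (suc j) π)
  not-le⇒ge π not-le =
    ≤⇒≤ᵇ (subst (_≤ crankMinuend (ω π) π) (sym (+-suc (ω π) j)) (≰⇒> (T-not⁻ not-le ∘ ≤⇒≤ᵇ)))

crankGeCount-rec : ∀ j M → 1 ≤ j → crankGeCount j (j + M) + crankGeCount (suc j) M ≡ count (λ _ → true) M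
crankGeCount-rec 1             zero    _   =
  trans (cong (1 +_) (count-crankGe-small 2 0 (s≤s z≤n))) (sym (count≡countPartitions (λ _ → true) 0))
crankGeCount-rec 1             (suc M) 1≤j =
  trans (cong (count (crankGe 1) (2 + M) +_) (crankGeCount-≥2 0 (suc M))) (count-crankGe-rec 1 (suc M) 1≤j (s≤s (m≤n+m 1 M)))
crankGeCount-rec (suc (suc j)) M       1≤j =
  trans (cong (count (crankGe (2 + j)) (2 + j + M) +_) (crankGeCount-≥2 (suc j) M))
        (count-crankGe-rec (2 + j) M 1≤j (≤-trans (s≤s (s≤s z≤n)) (m≤n+m (2 + j) M)))

crankGeCount-small : ∀ j n → 1 ≤ j → n < j → crankGeCount j n ≡ 0
crankGeCount-small 1             zero    _ _   = count-crankGe-small 1 0 ≤-refl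
crankGeCount-small 1             (suc _) _ (s≤s ())
crankGeCount-small (suc (suc j)) n       _ n<j = trans (crankGeCount-≥2 j n) (count-crankGe-small (2 + j) n n<j)

mexOffsetOdd : ℕ → List ℕ → Bool
mexOffsetOdd j π = (mex 1 j π % 2) ≡ᵇ (suc j % 2)

mex-∉ : ∀ j π → memB j π ≡ false → mex 1 j π ≡ j
mex-∉ j π j∉π rewrite +-identityʳ j | j∉π = refl

mexFrom-insert : ∀ fuel j k σ → mexFrom fuel 1 j (suc k) (insert j σ) ≡ mexFrom fuel 1 (suc j) k σ
mexFrom-insert zero       j k σ = +-suc j (k * 1)
mexFrom-insert (suc fuel) j k σ = begin
  (if memB (j + suc k * 1) (insert j σ) then next else j + suc k * 1)
    ≡⟨ cong (λ y → if memB y (insert j σ) then next else y) (+-suc j (k * 1)) ⟩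
  (if memB x (insert j σ) then next else x)
    ≡⟨ cong (λ b → if b then next else x) (trans (memB-insert x j σ) (cong (_∨ memB x σ) (≢⇒≡ᵇ≡false (≢-sym (m≢1+m+n j))))) ⟩
  (if memB x σ then next else x)
    ≡⟨ cong (λ y → if memB x σ then y else x) (mexFrom-insert fuel j (suc k) σ) ⟩
  (if memB x σ then mexFrom fuel 1 (suc j) (suc k) σ else x) ∎
  where
  open ≡-Reasoning
  x = suc j + k * 1
  next = mexFrom fuel 1 j (suc (suc k)) (insert j σ)

mex-insert : ∀ j σ → mex 1 j (insert j σ) ≡ mex 1 (suc j) σ
mex-insert j σ = begin
  mex 1 j (insert j σ)
    ≡⟨ cong (λ ℓ → mexFrom (suc ℓ) 1 j 0 (insert j σ)) (length-insert j σ) ⟩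
  mexFrom (suc (suc (length σ))) 1 j 0 (insert j σ)
    ≡⟨ cong (λ b → if b then mexFrom (suc (length σ)) 1 j 1 (insert j σ) else j + 0) j∈ ⟩
  mexFrom (suc (length σ)) 1 j 1 (insert j σ)
    ≡⟨ mexFrom-insert (suc (length σ)) j 0 σ ⟩
  mex 1 (suc j) σ ∎
  where
  open ≡-Reasoning
  j∈ : memB (j + 0) (insert j σ) ≡ true
  j∈ = trans (memB-insert (j + 0) j σ) (cong (_∨ memB (j + 0) σ) (T⇒true (≡⇒≡ᵇ (j + 0) j (+-identityʳ j))))

%2-cases : ∀ m → (m % 2 ≡ 0 × suc m % 2 ≡ 1) ⊎ (m % 2 ≡ 1 × suc m % 2 ≡ 0)
%2-cases zero          = inj₁ (refl , refl)
%2-cases (suc zero)    = inj₂ (refl , refl)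
%2-cases (suc (suc m)) = %2-cases m

parity-flip : ∀ m j → (m % 2 ≡ᵇ suc j % 2) ≡ not (m % 2 ≡ᵇ j % 2)
parity-flip m j with %2-cases m | %2-cases j
... | inj₁ (m0 , _) | inj₁ (j0 , j1) rewrite m0 | j0 | j1 = refl
... | inj₁ (m0 , _) | inj₂ (j1 , j0) rewrite m0 | j0 | j1 = refl
... | inj₂ (m1 , _) | inj₁ (j0 , j1) rewrite m1 | j0 | j1 = refl
... | inj₂ (m1 , _) | inj₂ (j1 , j0) rewrite m1 | j0 | j1 = refl

mexOffsetOdd-∉ : ∀ j π → memB j π ≡ false → mexOffsetOdd j π ≡ false
mexOffsetOdd-∉ j π j∉π with %2-cases j | mex-∉ j π j∉π
... | inj₁ (j0 , j1) | mex≡j rewrite mex≡j | j0 | j1 = refl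
... | inj₂ (j1 , j0) | mex≡j rewrite mex≡j | j0 | j1 = refl

count-mexOffsetOdd-rec : ∀ j M → 1 ≤ j →
  count (mexOffsetOdd j) (j + M) + count (mexOffsetOdd (suc j)) M ≡ count (λ _ → true) M
count-mexOffsetOdd-rec j M 1≤j = begin
  count (mexOffsetOdd j) (j + M) + next
    ≡⟨ cong (_+ next) (count-cong-≡ (λ {π} _ → j∈-needed π)) ⟩
  count (λ π → memB j π ∧ mexOffsetOdd j π) (j + M) + next
    ≡⟨ cong (_+ next) (count-insert M (mexOffsetOdd j) 1≤j) ⟩
  count (λ σ → mexOffsetOdd j (insert j σ)) M + next
    ≡⟨ cong (_+ next) (count-cong-≡ (λ {σ} _ → parity-insert σ)) ⟩
  count (λ σ → not (mexOffsetOdd (suc j) σ)) M + next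
    ≡⟨ +-comm _ next ⟩
  next + count (λ σ → not (mexOffsetOdd (suc j) σ)) M
    ≡⟨ count-split (λ _ → true) (mexOffsetOdd (suc j)) M ⟨
  count (λ _ → true) M ∎
  where
  open ≡-Reasoning
  next = count (mexOffsetOdd (suc j)) M
  j∈-needed : ∀ π → mexOffsetOdd j π ≡ memB j π ∧ mexOffsetOdd j π
  j∈-needed π with memB j π in j∈π
  ... | true  = refl
  ... | false = mexOffsetOdd-∉ j π j∈π
  parity-insert : ∀ σ → mexOffsetOdd j (insert j σ) ≡ not (mexOffsetOdd (suc j) σ)
  parity-insert σ = begin
    (mex 1 j (insert j σ) % 2 ≡ᵇ suc j % 2)               ≡⟨ cong (λ m → m % 2 ≡ᵇ suc j % 2) (mex-insert j σ) ⟩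
    (mex 1 (suc j) σ % 2 ≡ᵇ suc j % 2)                    ≡⟨ not-involutive _ ⟨
    not (not (mex 1 (suc j) σ % 2 ≡ᵇ suc j % 2))          ≡⟨ cong not (parity-flip (mex 1 (suc j) σ) (suc j)) ⟨
    not (mex 1 (suc j) σ % 2 ≡ᵇ suc (suc j) % 2)          ∎

count-mexOffsetOdd-small : ∀ j n → n < j → count (mexOffsetOdd j) n ≡ 0
count-mexOffsetOdd-small j n n<j = count-none λ {π} (p , _) → subst T (mexOffsetOdd-∉ j π (j∉ p))
  where
  j∉ : ∀ {π} → Parts≤ n π → memB j π ≡ false
  j∉ {π} p with memB j π in j∈π
  ... | true  = ⊥-elim (<⇒≱ n<j (memB⇒≤ p (true⇒T j∈π)))
  ... | false = refl

recurrence-unique : ∀ (X Y : ℕ → ℕ → ℕ) (p : ℕ → ℕ) →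
  (∀ j M → 1 ≤ j → X j (j + M) + X (suc j) M ≡ p M) →
  (∀ j M → 1 ≤ j → Y j (j + M) + Y (suc j) M ≡ p M) →
  (∀ j n → 1 ≤ j → n < j → X j n ≡ 0) →
  (∀ j n → 1 ≤ j → n < j → Y j n ≡ 0) →
  ∀ j n → 1 ≤ j → X j n ≡ Y j n
recurrence-unique X Y p X-rec Y-rec X-small Y-small j n = <-rec (λ n → ∀ j → 1 ≤ j → X j n ≡ Y j n) step n j
  where
  step : ∀ n → (∀ {m} → m < n → ∀ j → 1 ≤ j → X j m ≡ Y j m) → ∀ j → 1 ≤ j → X j n ≡ Y j n
  step n rec j 1≤j with j ≤? n
  ... | no j≰n = trans (X-small j n 1≤j (≰⇒> j≰n)) (sym (Y-small j n 1≤j (≰⇒> j≰n)))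
  ... | yes j≤n with M , refl ← m≤n⇒∃[o]m+o≡n j≤n = +-cancelʳ-≡ _ _ _ (begin
    X j (j + M) + X (suc j) M   ≡⟨ X-rec j M 1≤j ⟩
    p M                         ≡⟨ Y-rec j M 1≤j ⟨
    Y j (j + M) + Y (suc j) M   ≡⟨ cong (Y j (j + M) +_) (rec (m<n+m M 1≤j) (suc j) (s≤s z≤n)) ⟨
    Y j (j + M) + X (suc j) M   ∎)
    where open ≡-Reasoning

open import Data.Integer using (+_; _-_) renaming (_+_ to _+ℤ_)

largestPart≡firstPart : ∀ {k π} → Parts≤ k π → largestPart π ≡ firstPart π
largestPart≡firstPart [] = refl
largestPart≡firstPart {π = x ∷ xs} (cons _ _ p) =
  trans (cong (x ⊔_) (largestPart≡firstPart p)) (m≥n⇒m⊔n≡m (firstPart≤ p))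

crank≡minuend-ω : ∀ {k π} → Parts≤ k π → crank π ≡ + crankMinuend (ω π) π - + ω π
crank≡minuend-ω {π = π} p with ω π in ωπ≡
... | zero  = cong +_ (trans (largestPart≡firstPart p) (sym (+-identityʳ _)))
... | suc w = cong (λ v → + partsAbove v π - + suc w) ωπ≡

+-+≡+⇔ : ∀ a b m → (+ a - + b ≡ + m) ⇔ (b ≤ a × a ∸ b ≡ m)
+-+≡+⇔ a b m = mk⇔ to from
  where
  to : + a - + b ≡ + m → b ≤ a × a ∸ b ≡ m
  to eq with b ≤? a
  ... | yes b≤a = b≤a , ℤ.+-injective (trans (sym (ℤ.⊖-≥ b≤a)) (trans (sym (ℤ.m-n≡m⊖n a b)) eq))
  ... | no b≰a with b ∸ a | m<n⇒0<n∸m (≰⇒> b≰a) | ℤ.⊖-< (≰⇒> b≰a)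
  ...   | suc _ | _ | a⊖b≡ with () ← trans (sym (trans (ℤ.m-n≡m⊖n a b) a⊖b≡)) eq
  from : b ≤ a × a ∸ b ≡ m → + a - + b ≡ + m
  from (b≤a , a∸b≡m) = trans (ℤ.m-n≡m⊖n a b) (trans (ℤ.⊖-≥ b≤a) (cong +_ a∸b≡m))

crank≡⇔fibre : ∀ {k j m π} → Parts≤ k π → j ≤ m →
  T ⌊ crank π ℤ.≟ + m ⌋ ⇔ T (crankGe j π ∧ (crankMinuend (ω π) π ∸ ω π ≡ᵇ m))
crank≡⇔fibre {j = j} {m} {π} p j≤m = mk⇔ to from
  where
  c = crankMinuend (ω π) π
  to : T ⌊ crank π ℤ.≟ + m ⌋ → T (crankGe j π ∧ (c ∸ ω π ≡ᵇ m))
  to t =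
    let ω≤c , c∸ω≡m = Equivalence.to (+-+≡+⇔ c (ω π) m) (trans (sym (crank≡minuend-ω p)) (toWitness t))
    in ∧-intro (≤⇒≤ᵇ (subst (ω π + j ≤_) (trans (cong (_+_ (ω π)) (sym c∸ω≡m)) (m+[n∸m]≡n ω≤c)) (+-monoʳ-≤ (ω π) j≤m)))
               (≡⇒≡ᵇ (c ∸ ω π) m c∸ω≡m)
  from : T (crankGe j π ∧ (c ∸ ω π ≡ᵇ m)) → T ⌊ crank π ℤ.≟ + m ⌋
  from t =
    let ω+j≤c , c∸ω≡m = ∧-elim {crankGe j π} t
    in fromWitness (trans (crank≡minuend-ω p)
         (Equivalence.from (+-+≡+⇔ c (ω π) m) (m+n≤o⇒m≤o (ω π) (≤ᵇ⇒≤ (ω π + j) c ω+j≤c) , ≡ᵇ⇒≡ (c ∸ ω π) m c∸ω≡m)))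

sumRange-+ : ∀ f a l → sumRange (λ m → + f m) a l ≡ + sumRangeℕ f a l
sumRange-+ f a zero    = refl
sumRange-+ f a (suc l) = trans (cong (+ f a +ℤ_) (sumRange-+ f (suc a) l)) (sym (ℤ.pos-+ (f a) _))

crankGeqCount≡ : ∀ j n → 1 ≤ j → crankGeqCount j n ≡ + crankGeCount j n
crankGeqCount≡ 1             0 _ = cong +_ (sym (count-crankGe-small 1 0 ≤-refl))
crankGeqCount≡ 1             1 _ = refl
crankGeqCount≡ (suc (suc j)) 0 _ rewrite 0∸n≡0 j = cong +_ (sym (count-crankGe-small (suc (suc j)) 0 (s≤s z≤n)))
crankGeqCount≡ (suc (suc j)) 1 _ rewrite 0∸n≡0 j = cong +_ (sym (count-crankGe-small (suc (suc j)) 1 (s≤s (s≤s z≤n))))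
crankGeqCount≡ j n@(suc (suc _)) 1≤j = begin
  sumRange (λ m → + countPartitions (λ π → ⌊ crank π ℤ.≟ + m ⌋) n) j l
    ≡⟨ sumRange-+ (λ m → countPartitions (λ π → ⌊ crank π ℤ.≟ + m ⌋) n) j l ⟩
  + sumRangeℕ (λ m → countPartitions (λ π → ⌊ crank π ℤ.≟ + m ⌋) n) j l
    ≡⟨ cong +_ (sumRangeℕ-cong j l fibre) ⟩
  + sumRangeℕ (λ m → count (λ π → crankGe j π ∧ (s π ≡ᵇ m)) n) j l
    ≡⟨ cong +_ (count-fibres (crankGe j) s j l n bounds) ⟨
  + count (crankGe j) n ∎
  where
  open ≡-Reasoning
  l = suc n ∸ j
  s : List ℕ → ℕ
  s π = crankMinuend (ω π) π ∸ ω π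
  fibre : ∀ m → j ≤ m → m < j + l →
    countPartitions (λ π → ⌊ crank π ℤ.≟ + m ⌋) n ≡ count (λ π → crankGe j π ∧ (s π ≡ᵇ m)) n
  fibre m j≤m _ = trans (sym (count≡countPartitions _ n))
    (count-cong (λ (p , _) → Equivalence.to (crank≡⇔fibre p j≤m)) (λ (p , _) → Equivalence.from (crank≡⇔fibre p j≤m)))
  bounds : ∀ {π} → π ⊢ n → T (crankGe j π) → j ≤ s π × s π < j + l
  bounds {π} (p , sum≡) t =
    let ω+j≤c = ≤ᵇ⇒≤ (ω π + j) _ t in
    m+n≤o⇒m≤o∸n j (subst (_≤ crankMinuend (ω π) π) (+-comm (ω π) j) ω+j≤c) ,
    ≤-trans (s≤s (≤-trans (m∸n≤m _ (ω π)) (subst (crankMinuend (ω π) π ≤_) sum≡ (crankMinuend≤sum (ω π) π p))))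
            (m≤n+m∸n (suc n) j)

theorem3p6 : (j n : ℕ) → 1 Data.Nat.≤ j → 1 Data.Nat.≤ n →
    + pbar 1 j n ≡ crankGeqCount j n
theorem3p6 j n 1≤j _ = begin
  + pbar 1 j n                  ≡⟨ cong +_ (count≡countPartitions (mexOffsetOdd j) n) ⟨
  + count (mexOffsetOdd j) n    ≡⟨ cong +_ (recurrence-unique (λ j → count (mexOffsetOdd j)) crankGeCount (count (λ _ → true))
                                              count-mexOffsetOdd-rec crankGeCount-rec
                                              (λ j n _ → count-mexOffsetOdd-small j n) crankGeCount-small j n 1≤j) ⟩
  + crankGeCount j n            ≡⟨ crankGeqCount≡ j n 1≤j ⟨
  crankGeqCount j n             ∎
  where open ≡-Reasoning
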